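{- Let $n\ge1$, let $T$ be the tour $0\to1\to\cdots\to n-1\to0$ on the complete graph with vertex set $\{0,\dots,n-1\}$, and let $S=(i_1,i_2,i_3,i_4)$ be a complete selection. Under the action of the dihedral group $\mathcal G$ of order 8 on the set $\mathcal I(S)$ of pure reinsertion sets for $S$ (defined in the context), the set $\mathcal I(S)$ (equivalently, the set of pure reinsertion schemes) is partitioned into exactly $7$ orbits.
   Context: Arithmetic on vertices is modulo $n$: $x\oplus t=(x+t)\bmod n$. A selection is a quadruple $S=(i_1,i_2,i_3,i_4)$ with $0\le i_1<i_2<i_3<i_4\le n-1$, with removal set $R(S)=\{\{i_j,i_j\oplus1\}: j=1,\dots,4\}$; it is complete if $i_h\oplus1\notin\{i_1,\dots,i_4\}$ for all $h$. A reinsertion set for $S$ is a set $I$ of four edges such that $(T\setminus R(S))\cup I$ is a Hamiltonian cycle; it is pure if $I\cap R(S)=\emptyset$. Label the eight endpoints of the removed edges symbolically: label $l$ denotes vertex $i_l$ and label $l'$ denotes vertex $i_l\oplus1$, for $l=1,\dots,4$; thus a reinsertion set is written as a set of four pairs of labels from $\{1,1',2,2',3,3',4,4'\}$. Let $\rho$ be the permutation of $\{1,2,3,4\}$ with $\rho(1)=2,\rho(2)=3,\rho(3)=4,\rho(4)=1$, and $\psi$ the permutation with $\psi(1)=3,\psi(2)=2,\psi(3)=1,\psi(4)=4$. Let $\mathcal G=\{\rho^j,\ \psi\rho^j : j=0,1,2,3\}$ (the group generated by $\rho,\psi$, of order 8). For $\varphi\in\mathcal G$ define a relabelling $L_\varphi$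 by: if $\varphi=\rho^j$ for some $j$, then $L_\varphi(x)=\varphi(x)$ and $L_\varphi(x')=\varphi(x)'$; otherwise $L_\varphi(x)=\varphi(x)'$ and $L_\varphi(x')=\varphi(x)$. The action is $\varphi I=\{\{L_\varphi(x),L_\varphi(y)\}:\{x,y\}\in I\}$, and the orbit of $I$ is $\{\varphi I:\varphi\in\mathcal G\}$. Reinsertion schemes (signed permutations of $\{2,3,4\}$ describing the order and direction in which the segments $2,3,4$ are visited after segment 1, where segment $l$ is the path of $T\setminus R(S)$ ending at $i_l$) are in bijection with reinsertion sets, and the action is transferred to schemes via this bijection. -}

module Defs where

open import Data.Nat using (ℕ; zero; suc; _<_; NonZero)
open import Data.Nat.DivMod using (_%_)
open import Data.Fin using (Fin; zero; suc; toℕ)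
open import Data.Bool using (Bool; true; false; not; if_then_else_)
open import Data.Product using (Σ; ∃; ∃-syntax; _×_; _,_; proj₁; proj₂)
open import Data.Sum using (_⊎_)
open import Data.List using (List; length)
open import Data.List.Relation.Unary.Any using (Any)
open import Data.List.Relation.Unary.All using (All)
open import Data.List.Relation.Unary.AllPairs using (AllPairs)
open import Relation.Nullary using (¬_)
open import Relation.Binary.PropositionalEquality using (_≡_; _≢_)
open import Function.Bundles using (_⇔_)

_⊕1 : {n : ℕ} → .{{NonZero n}} → ℕ → ℕ
_⊕1 {n} x = suc x % n

-- A (possibly directed-looking) pair (a , b) represents the undirected
-- edge {a , b}.
Edge : Set
Edge = ℕ × ℕ

Adj : ℕ → ℕ → ℕ → ℕ → Set
Adj x y a b = (a ≡ x × b ≡ y) ⊎ (a ≡ y × b ≡ x)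

SameEdge : Edge → Edge → Set
SameEdge (x , y) (a , b) = Adj x y a b

EdgeSet : Set₁
EdgeSet = ℕ → ℕ → Set

⟦_⟧ : List Edge → EdgeSet
⟦ es ⟧ a b = Any (λ e → SameEdge e (a , b)) es

_∪_ : EdgeSet → EdgeSet → EdgeSet
(A ∪ B) a b = A a b ⊎ B a b

_≐_ : EdgeSet → EdgeSet → Set
A ≐ B = ∀ a b → A a b ⇔ B a b

IsEdge : ℕ → Edge → Set
IsEdge n (a , b) = a < n × b < n × a ≢ b

HamCycle : (n : ℕ) → .{{NonZero n}} → EdgeSet → Set
HamCycle n H =
  Σ (ℕ → ℕ) λ v →
    (∀ k → k < n → v k < n) ×
    (∀ k l → k < n → l < n → v k ≡ v l → k ≡ l) ×
    (∀ a b → H a b ⇔ (∃[ k ] (k < n × Adj (v k) (v (suc k % n)) a b)))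

-- Selections.  Indices 1,2,3,4 of the paper are 0,1,2,3 : Fin 4.

record Selection (n : ℕ) : Set where
  field
    i₁ i₂ i₃ i₄ : ℕ
    i₁<i₂ : i₁ < i₂
    i₂<i₃ : i₂ < i₃
    i₃<i₄ : i₃ < i₄
    i₄<n  : i₄ < n

open Selection public

idx : {n : ℕ} → Selection n → Fin 4 → ℕ
idx S zero                   = i₁ S
idx S (suc zero)             = i₂ S
idx S (suc (suc zero))       = i₃ S
idx S (suc (suc (suc zero))) = i₄ S

InSel : {n : ℕ} → Selection n → ℕ → Set
InSel S x = ∃[ h ] (x ≡ idx S h)

Complete : {n : ℕ} → .{{NonZero n}} → Selection n → Set
Complete {n} S = ∀ h → ¬ InSel S (_⊕1 {n} (idx S h))

removed : {n : ℕ} → .{{NonZero n}} → Selection n → Fin 4 → Edge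
removed {n} S j = idx S j , _⊕1 {n} (idx S j)

TminusR : {n : ℕ} → .{{NonZero n}} → Selection n → EdgeSet
TminusR {n} S a b = ∃[ x ] (x < n × ¬ InSel S x × Adj x (_⊕1 {n} x) a b)

-- I is a reinsertion set: a set of four edges (a duplicate-free list of
-- four edges of the complete graph) with (T \ R(S)) ∪ I Hamiltonian.
ReinsertionSet : {n : ℕ} → .{{NonZero n}} → Selection n → List Edge → Set
ReinsertionSet {n} S I =
  length I ≡ 4 ×
  All (IsEdge n) I ×
  AllPairs (λ e f → ¬ SameEdge e f) I ×
  HamCycle n (TminusR S ∪ ⟦ I ⟧)

PureReinsertionSet : {n : ℕ} → .{{NonZero n}} → Selection n → List Edge → Set
PureReinsertionSet S I =
  ReinsertionSet S I × All (λ e → ∀ j → ¬ SameEdge e (removed S j)) I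

-- Labels: (l , false) is label l (vertex i_l), (l , true) is label l'
-- (vertex i_l ⊕ 1).

Label : Set
Label = Fin 4 × Bool

vtx : {n : ℕ} → .{{NonZero n}} → Selection n → Label → ℕ
vtx S (l , false) = idx S l
vtx {n} S (l , true) = _⊕1 {n} (idx S l)

ρ : Fin 4 → Fin 4
ρ zero                   = suc zero
ρ (suc zero)             = suc (suc zero)
ρ (suc (suc zero))       = suc (suc (suc zero))
ρ (suc (suc (suc zero))) = zero

ψ : Fin 4 → Fin 4
ψ zero                   = suc (suc zero)
ψ (suc zero)             = suc zero
ψ (suc (suc zero))       = zero
ψ (suc (suc (suc zero))) = suc (suc (suc zero))

ρ^ : ℕ → Fin 4 → Fin 4
ρ^ zero    x = x
ρ^ (suc j) x = ρ (ρ^ j x)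

-- The group 𝒢: (false , j) is ρ^j and (true , j) is ψ ρ^j.
G : Set
G = Bool × Fin 4

perm : G → Fin 4 → Fin 4
perm (false , j) x = ρ^ (toℕ j) x
perm (true  , j) x = ψ (ρ^ (toℕ j) x)

L : G → Label → Label
L (false , j) (x , p) = perm (false , j) x , p
L (true  , j) (x , p) = perm (true  , j) x , not p

act : {n : ℕ} → .{{NonZero n}} → Selection n → G → List Edge → EdgeSet
act S φ I a b =
  ∃[ x ] ∃[ y ] (⟦ I ⟧ (vtx S x) (vtx S y) ×
                 a ≡ vtx S (L φ x) × b ≡ vtx S (L φ y))

SameOrbit : {n : ℕ} → .{{NonZero n}} → Selection n → List Edge → List Edge → Set
SameOrbit S I J = ∃[ φ ] (act S φ I ≐ ⟦ J ⟧)

module Submission where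

open import Defs
open import Data.Nat using (ℕ; zero; suc; _+_; _*_; _∸_; _<_; _≤_; z≤n; s≤s; s≤s⁻¹; pred; NonZero; _≟_; _<?_; _≤?_)
open import Data.Nat.Properties
open import Data.Nat.DivMod using (_%_; _/_; m<n⇒m%n≡m; n%n≡0; m%n<n; m≡m%n+[m/n]*n; %-distribˡ-+; m%n%n≡m%n; [m+n]%n≡m%n)
open import Data.Nat.GeneralisedArithmetic using (fold; fold-+)
open import Data.Fin using (Fin; zero; suc; toℕ; fromℕ<; punchOut)
open import Data.Fin.Properties using (pigeonhole; toℕ-fromℕ<; toℕ-injective; toℕ<n; punchOut-injective; all?; any?) renaming (_≟_ to _≟ᶠ_)
open import Data.Fin.Subset.Properties using (anySubset?)
open import Data.Bool using (Bool; true; false; not; if_then_else_)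
open import Data.Bool.Properties using (not-¬) renaming (_≟_ to _≟ᵇ_)
open import Data.Product using (Σ; ∃; ∃-syntax; _×_; _,_; proj₁; proj₂; swap)
open import Data.Product.Properties using (≡-dec)
open import Data.Sum using (_⊎_; inj₁; inj₂)
open import Data.Empty using (⊥; ⊥-elim)
open import Relation.Nullary using (¬_; Dec; yes; no; does; ¬?; _×-dec_; _⊎-dec_; _→-dec_)
open import Relation.Nullary.Decidable using (from-yes)
open import Relation.Binary using (DecidableEquality; tri<; tri≈; tri>)
open import Relation.Binary.PropositionalEquality hiding (J)
open import Function.Bundles using (_⇔_; mk⇔; Equivalence)
open import Function.Construct.Symmetry using (⇔-sym)
open import Function.Construct.Composition using (_⇔-∘_)
open import Data.Sum.Function.Propositional using (_⊎-⇔_)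
open import Data.List using (List; []; _∷_; length; map; concatMap; filter; tabulate; cartesianProduct; lookup)
open import Data.List.Properties using (length-filter)
open import Data.List.Membership.Propositional using (_∈_; find)
open import Data.List.Membership.Propositional.Properties using (∈-filter⁺; ∈-filter⁻)
import Data.List.Membership.DecPropositional as DecMembership
open import Data.List.Relation.Unary.All as All using (All; []; _∷_)
open import Data.List.Relation.Unary.Any as Any using (Any; here; there; index)
open import Data.List.Relation.Unary.AllPairs using (AllPairs; []; _∷_)
open import Data.List.Relation.Unary.Unique.Propositional using (Unique)
import Data.List.Relation.Unary.All.Properties as Allₚ
import Data.List.Relation.Unary.Any.Properties as Anyₚ
import Data.List.Relation.Unary.AllPairs.Properties as AllPairsₚ
import Data.List.Relation.Unary.Unique.Propositional.Properties as Uniqueₚ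
import Data.List.Relation.Unary.Unique.DecPropositional as DecUnique
open import Data.Vec as Vec using (Vec; []; _∷_)

-- Rotate i₁ ⊕ 1 to 0: then T ∖ R(S) consists of four paths on consecutive intervals, each with at least
-- two vertices because S is complete. In a Hamiltonian cycle through these paths every one of the eight ends
-- has exactly one further edge, and it leads to another end; so the four reinserted edges pair up the ends,
-- avoid the removed edges (purity) and connect the paths. Listing the 105 pairings of eight ends shows that
-- these are exactly the links of the 25 pure reinsertion schemes, and conversely walking along a scheme
-- traces a single cycle through all vertices. Relabelled by 𝒢, the 25 link sets fall into 7 orbits, which
-- is checked by computation.

pattern f0 = zero
pattern f1 = suc zero
pattern f2 = suc (suc zero)
pattern f3 = suc (suc (suc zero))

suc-mod-cases : ∀ {n k} .{{_ : NonZero n}} → k < n →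
                (suc k < n × suc k % n ≡ suc k) ⊎ (suc k ≡ n × suc k % n ≡ 0)
suc-mod-cases {n} k<n with m≤n⇒m<n∨m≡n k<n
... | inj₁ lt = inj₁ (lt , m<n⇒m%n≡m lt)
... | inj₂ refl = inj₂ (refl , n%n≡0 n)

Adj-swap : ∀ {x y a b} → Adj x y a b → Adj x y b a
Adj-swap (inj₁ (p , q)) = inj₂ (q , p)
Adj-swap (inj₂ (p , q)) = inj₁ (q , p)

Adj-flip : ∀ {x y a b} → Adj x y a b → Adj y x a b
Adj-flip (inj₁ (p , q)) = inj₂ (p , q)
Adj-flip (inj₂ (p , q)) = inj₁ (p , q)

Adj-map : ∀ (f : ℕ → ℕ) {x y a b} → Adj x y a b → Adj (f x) (f y) (f a) (f b)
Adj-map f (inj₁ (p , q)) = inj₁ (cong f p , cong f q)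
Adj-map f (inj₂ (p , q)) = inj₂ (cong f p , cong f q)

SameEdge-sym : ∀ e f → SameEdge e f → SameEdge f e
SameEdge-sym _ _ (inj₁ (refl , refl)) = inj₁ (refl , refl)
SameEdge-sym _ _ (inj₂ (refl , refl)) = inj₂ (refl , refl)

SameEdge-trans : ∀ e f g → SameEdge e f → SameEdge f g → SameEdge e g
SameEdge-trans _ _ _ (inj₁ (refl , refl)) s = s
SameEdge-trans _ _ _ (inj₂ (refl , refl)) (inj₁ (refl , refl)) = inj₂ (refl , refl)
SameEdge-trans _ _ _ (inj₂ (refl , refl)) (inj₂ (refl , refl)) = inj₁ (refl , refl)

⟦⟧-sym : ∀ I {a b} → ⟦ I ⟧ a b → ⟦ I ⟧ b a
⟦⟧-sym I = Any.map Adj-swap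

⟦⟧-bounded : ∀ {n} I → All (λ e → proj₁ e < n × proj₂ e < n) I → ∀ {a b} → ⟦ I ⟧ a b → a < n × b < n
⟦⟧-bounded I bounded ab∈I with find ab∈I
... | e , e∈I , inj₁ (refl , refl) = All.lookup bounded e∈I
... | e , e∈I , inj₂ (refl , refl) = proj₂ (All.lookup bounded e∈I) , proj₁ (All.lookup bounded e∈I)

injective⇒surjective : ∀ {n} (g : Fin n → Fin n) → (∀ i j → g i ≡ g j → i ≡ j) → ∀ q → ∃[ i ] (g i ≡ q)
injective⇒surjective {suc n} g g-injective q with any? (λ i → g i ≟ᶠ q)
... | yes hit = hit
... | no miss with pigeonhole (n<1+n n) (λ i → punchOut {i = q} {j = g i} λ e → miss (i , sym e))
... | i , j , i<j , same = ⊥-elim (<-irrefl (cong toℕ (g-injective i j (punchOut-injective (λ e → miss (i , sym e)) (λ e → miss (j , sym e)) same))) i<j)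

AtMost4Edges : EdgeSet → Set
AtMost4Edges X = ∀ (f : Fin 4 → Edge) → (∀ i j → SameEdge (f i) (f j) → i ≡ j) → (∀ i → X (proj₁ (f i)) (proj₂ (f i))) →
                 ∀ p q → X p q → ∃[ i ] SameEdge (f i) (p , q)

⟦⟧-exhausted : ∀ {n} (I : List Edge) → length I ≡ n → (f : Fin n → Edge) → (∀ i j → SameEdge (f i) (f j) → i ≡ j) →
               (∀ i → ⟦ I ⟧ (proj₁ (f i)) (proj₂ (f i))) → ∀ a b → ⟦ I ⟧ a b → ∃[ i ] SameEdge (f i) (a , b)
⟦⟧-exhausted I refl f f-distinct f∈I a b ab∈I with injective⇒surjective place place-injective (index ab∈I)
  where
  place : Fin (length I) → Fin (length I)
  place i = index (f∈I i)
  at-place : ∀ i → SameEdge (f i) (lookup I (place i))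
  at-place i = SameEdge-sym _ (f i) (Anyₚ.lookup-index (f∈I i))
  place-injective : ∀ i j → place i ≡ place j → i ≡ j
  place-injective i j e = f-distinct i j (SameEdge-trans (f i) _ (f j) (at-place i) (subst (λ k → SameEdge (lookup I k) (f j)) (sym e) (SameEdge-sym (f j) _ (at-place j))))
... | i , e = i , SameEdge-trans (f i) _ (a , b) (SameEdge-sym _ (f i) (Anyₚ.lookup-index (f∈I i)))
                   (subst (λ k → SameEdge (lookup I k) (a , b)) (sym e) (Anyₚ.lookup-index ab∈I))

≐-sym : ∀ {A B : EdgeSet} → A ≐ B → B ≐ A
≐-sym f a b = ⇔-sym (f a b)

≐-trans : ∀ {A B C : EdgeSet} → A ≐ B → B ≐ C → A ≐ C
≐-trans f g a b = g a b ⇔-∘ f a b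

act-cong : ∀ {n} .{{_ : NonZero n}} (S : Selection n) φ {I J} → ⟦ I ⟧ ≐ ⟦ J ⟧ → act S φ I ≐ act S φ J
act-cong S φ I≐J a b = mk⇔ (λ { (x , y , i , p , q) → x , y , Equivalence.to (I≐J _ _) i , p , q })
                           (λ { (x , y , j , p , q) → x , y , Equivalence.from (I≐J _ _) j , p , q })

-- Hamiltonian cycles

module HamiltonianCycle (m : ℕ) (H : EdgeSet) (ham : HamCycle (suc m) H) where
  private
    n : ℕ
    n = suc m
    v : ℕ → ℕ
    v = proj₁ ham
    v-injective : ∀ k l → k < n → l < n → v k ≡ v l → k ≡ l
    v-injective = proj₁ (proj₂ (proj₂ ham))
    H⇔ : ∀ a b → H a b ⇔ (∃[ k ] (k < n × Adj (v k) (v (suc k % n)) a b))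
    H⇔ = proj₂ (proj₂ (proj₂ ham))

    next : ℕ → ℕ
    next k = suc k % n

    next< : ∀ k → next k < n
    next< k = m%n<n (suc k) n

    next-injective : ∀ j k → j < n → k < n → next j ≡ next k → j ≡ k
    next-injective j k j< k< e with suc-mod-cases j< | suc-mod-cases k<
    ... | inj₁ (_ , p) | inj₁ (_ , q) = suc-injective (trans (sym p) (trans e q))
    ... | inj₁ (_ , p) | inj₂ (_ , q) with () ← trans (sym p) (trans e q)
    ... | inj₂ (_ , p) | inj₁ (_ , q) with () ← trans (sym q) (trans (sym e) p)
    ... | inj₂ (p , _) | inj₂ (q , _) = suc-injective (trans p (sym q))

    next≢ : 2 ≤ n → ∀ k → k < n → next k ≢ k
    next≢ two k k< e with suc-mod-cases k<
    ... | inj₁ (_ , r) = 1+n≢n (trans (sym r) e)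
    ... | inj₂ (r , r') with refl ← trans (sym e) r' = <-irrefl refl (subst (2 ≤_) (sym r) two)

    prev : ℕ → ℕ
    prev zero = m
    prev (suc k) = k

    prev< : ∀ k → k < n → prev k < n
    prev< zero k< = ≤-refl
    prev< (suc k) k< = <-trans ≤-refl k<

    next-prev : ∀ k → k < n → next (prev k) ≡ k
    next-prev zero k< = n%n≡0 n
    next-prev (suc k) k< = m<n⇒m%n≡m k<

    next≢prev : 3 ≤ n → ∀ k → k < n → next k ≢ prev k
    next≢prev three zero k< e with suc-mod-cases k<
    ... | inj₁ (_ , r) = <-irrefl (trans (sym r) e) (s≤s⁻¹ three)
    ... | inj₂ (r , _) = <-irrefl r (≤-trans (s≤s (s≤s z≤n)) three)
    next≢prev three (suc k) k< e with suc-mod-cases k<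
    ... | inj₁ (_ , r) = <-irrefl (sym (trans (sym r) e)) (n≤1+n _)
    ... | inj₂ (r , r') with refl ← trans (sym r') e = <-irrefl r three

    cycle-edge : ∀ k → k < n → H (v k) (v (next k))
    cycle-edge k k< = Equivalence.from (H⇔ _ _) (k , k< , inj₁ (refl , refl))

    on-cycle : ∀ a b → H a b → ∃[ k ] (k < n × a ≡ v k)
    on-cycle a b h with Equivalence.to (H⇔ a b) h
    ... | k , k< , inj₁ (p , _) = k , k< , p
    ... | k , k< , inj₂ (p , _) = next k , next< k , p

    neighbour : ∀ k b → k < n → H (v k) b → b ≡ v (next k) ⊎ ∃[ j ] (j < n × next j ≡ k × b ≡ v j)
    neighbour k b k< h with Equivalence.to (H⇔ _ _) h
    ... | j , j< , inj₁ (p , q) with refl ← v-injective k j k< j< p = inj₁ q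
    ... | j , j< , inj₂ (p , q) = inj₂ (j , j< , sym (v-injective k (next j) k< (next< j) p) , q)

  H-sym : ∀ a b → H a b → H b a
  H-sym a b h with Equivalence.to (H⇔ a b) h
  ... | k , k< , ad = Equivalence.from (H⇔ b a) (k , k< , Adj-swap ad)

  degree≤2 : ∀ a b c d → H a b → H a c → H a d → b ≡ c ⊎ b ≡ d ⊎ c ≡ d
  degree≤2 a b c d hb hc hd with on-cycle a b hb
  ... | k , k< , refl with neighbour k b k< hb | neighbour k c k< hc | neighbour k d k< hd
  ... | inj₁ p | inj₁ q | _ = inj₁ (trans p (sym q))
  ... | inj₁ p | inj₂ _ | inj₁ r = inj₂ (inj₁ (trans p (sym r)))
  ... | inj₂ _ | inj₁ q | inj₁ r = inj₂ (inj₂ (trans q (sym r)))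
  ... | inj₂ (j , j< , e , p) | inj₂ (j' , j'< , e' , q) | _
        with refl ← next-injective j j' j< j'< (trans e (sym e')) = inj₁ (trans p (sym q))
  ... | inj₂ (j , j< , e , p) | inj₁ _ | inj₂ (j' , j'< , e' , q)
        with refl ← next-injective j j' j< j'< (trans e (sym e')) = inj₂ (inj₁ (trans p (sym q)))
  ... | inj₁ _ | inj₂ (j , j< , e , p) | inj₂ (j' , j'< , e' , q)
        with refl ← next-injective j j' j< j'< (trans e (sym e')) = inj₂ (inj₂ (trans p (sym q)))

  irreflexive : 2 ≤ n → ∀ a → ¬ H a a
  irreflexive two a h with Equivalence.to (H⇔ a a) h
  ... | k , k< , inj₁ (p , q) = next≢ two k k< (sym (v-injective k (next k) k< (next< k) (trans (sym p) q)))
  ... | k , k< , inj₂ (p , q) = next≢ two k k< (sym (v-injective k (next k) k< (next< k) (trans (sym q) p)))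

  degree≥2 : 3 ≤ n → ∀ a b → H a b → ∃[ c ] (H a c × c ≢ b)
  degree≥2 three a b h with on-cycle a b h
  ... | k , k< , refl with v (next k) ≟ b
  ...   | no ne = v (next k) , cycle-edge k k< , ne
  ...   | yes refl = v (prev k) , H-sym _ _ back , λ e → next≢prev three k k< (v-injective _ _ (next< k) (prev< k k<) (sym e))
    where
    back : H (v (prev k)) (v k)
    back = subst (λ z → H (v (prev k)) (v z)) (next-prev k k<) (cycle-edge (prev k) (prev< k k<))

  -- walk from a to the end of the cycle, wrap around to its start and walk on to c
  connected : (P : ℕ → Set) → (∀ a b → H a b → P a → P b) →
              ∀ a b → H a b → P a → ∀ c d → H c d → P c
  connected P closed a b h pa c d h' with on-cycle a b h | on-cycle c d h'
  ... | k₀ , k₀< , refl | k₁ , k₁< , refl = walk 0 k₁ k₁< from-0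
    where
    walk : ∀ i d → i + d < n → P (v i) → P (v (i + d))
    walk i zero i< p rewrite +-identityʳ i = p
    walk i (suc d) i< p rewrite +-suc i d =
      subst (λ z → P (v z)) (m<n⇒m%n≡m i<) (closed _ _ (cycle-edge (i + d) (<-trans ≤-refl i<)) (walk i d (<-trans ≤-refl i<) p))
    to-last : P (v m)
    to-last = subst (λ z → P (v z)) (m+[n∸m]≡n (s≤s⁻¹ k₀<))
                (walk k₀ (m ∸ k₀) (subst (_< n) (sym (m+[n∸m]≡n (s≤s⁻¹ k₀<))) ≤-refl) pa)
    from-0 : P (v 0)
    from-0 = subst (λ z → P (v z)) (n%n≡0 n) (closed _ _ (cycle-edge m ≤-refl) to-last)

-- A bijection s of {0,…,n-1} with a single cycle through x₀ gives the Hamiltonian cycle x₀, s x₀, s² x₀, …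
module CyclicSuccessor (m : ℕ) (s : ℕ → ℕ) (x₀ : ℕ)
  (s< : ∀ p → p < suc m → s p < suc m)
  (s-injective : ∀ p q → p < suc m → q < suc m → s p ≡ s q → p ≡ q)
  (x₀< : x₀ < suc m)
  (reach : ∀ y → y < suc m → ∃[ k ] (fold x₀ s k ≡ y)) where
  private
    n : ℕ
    n = suc m

    v : ℕ → ℕ
    v = fold x₀ s

    v< : ∀ k → v k < n
    v< zero = x₀<
    v< (suc k) = s< _ (v< k)

    cancel : ∀ i d → v (i + d) ≡ v i → v d ≡ x₀
    cancel zero d e = e
    cancel (suc i) d e = cancel i d (s-injective _ _ (v< (i + d)) (v< i) e)

    periodic : ∀ q .{{_ : NonZero q}} → v q ≡ x₀ → ∀ k → v k ≡ v (k % q)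
    periodic q e k = trans (cong v (m≡m%n+[m/n]*n k q)) (trans (fold-+ x₀ s (k % q)) (cong (λ z → fold z s (k % q)) (multiple (k / q))))
      where
      multiple : ∀ j → v (j * q) ≡ x₀
      multiple zero = refl
      multiple (suc j) = trans (fold-+ x₀ s q) (trans (cong (λ z → fold z s q) (multiple j)) e)

    -- A return time q < n would confine the n vertices to q residues.
    period-minimal : ∀ q → 0 < q → v q ≡ x₀ → n ≤ q
    period-minimal q@(suc _) _ e with q <? n
    ... | no q≮n = ≮⇒≥ q≮n
    ... | yes q<n with pigeonhole q<n residue
      where
      residue : Fin n → Fin q
      residue y = fromℕ< (m%n<n (proj₁ (reach (toℕ y) (toℕ<n y))) q)
    ... | i , j , i<j , same = ⊥-elim (<-irrefl (cong toℕ (toℕ-injective i≡j)) i<j)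
      where
      kᵢ = proj₁ (reach (toℕ i) (toℕ<n i))
      kⱼ = proj₁ (reach (toℕ j) (toℕ<n j))
      i≡j : toℕ i ≡ toℕ j
      i≡j = begin
        toℕ i       ≡⟨ sym (proj₂ (reach (toℕ i) (toℕ<n i))) ⟩
        v kᵢ        ≡⟨ periodic q e kᵢ ⟩
        v (kᵢ % q)  ≡⟨ cong v (trans (sym (toℕ-fromℕ< (m%n<n kᵢ q))) (trans (cong toℕ same) (toℕ-fromℕ< (m%n<n kⱼ q)))) ⟩
        v (kⱼ % q)  ≡⟨ sym (periodic q e kⱼ) ⟩
        v kⱼ        ≡⟨ proj₂ (reach (toℕ j) (toℕ<n j)) ⟩
        toℕ j       ∎
        where open ≡-Reasoning

    return-time : ∀ i j → i < j → v i ≡ v j → v (j ∸ i) ≡ x₀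
    return-time i j i<j e = cancel i (j ∸ i) (trans (cong v (m+[n∸m]≡n (<⇒≤ i<j))) (sym e))

    period : v n ≡ x₀
    period with pigeonhole ≤-refl (λ (k : Fin (suc n)) → fromℕ< (v< (toℕ k)))
    ... | i , j , i<j , same = subst (λ z → v z ≡ x₀) (≤-antisym (≤-trans (m∸n≤m (toℕ j) (toℕ i)) (s≤s⁻¹ (toℕ<n j)))
                                  (period-minimal _ (m<n⇒0<n∸m i<j) back)) back
      where
      back : v (toℕ j ∸ toℕ i) ≡ x₀
      back = return-time _ _ i<j (trans (sym (toℕ-fromℕ< (v< (toℕ i)))) (trans (cong toℕ same) (toℕ-fromℕ< (v< (toℕ j)))))

    v-injective : ∀ k l → k < n → l < n → v k ≡ v l → k ≡ l
    v-injective k l k< l< e with <-cmp k l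
    ... | tri≈ _ p _ = p
    ... | tri< lt _ _ = ⊥-elim (<⇒≱ (≤-<-trans (m∸n≤m l k) l<) (period-minimal _ (m<n⇒0<n∸m lt) (return-time k l lt e)))
    ... | tri> _ _ gt = ⊥-elim (<⇒≱ (≤-<-trans (m∸n≤m k l) k<) (period-minimal _ (m<n⇒0<n∸m gt) (return-time l k gt (sym e))))

    reach< : ∀ y → y < n → ∃[ k ] (k < n × v k ≡ y)
    reach< y y< with reach y y<
    ... | k , e = k % n , m%n<n k n , trans (sym (periodic n period k)) e

    v-next : ∀ k → k < n → v (suc k % n) ≡ s (v k)
    v-next k k< with suc-mod-cases k<
    ... | inj₁ (_ , r) = cong v r
    ... | inj₂ (r , r') = trans (cong v r') (trans (sym period) (cong v (sym r)))

  HamCycle-successor : (H : EdgeSet) → (∀ a b → H a b ⇔ (∃[ x ] (x < n × Adj x (s x) a b))) → HamCycle n H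
  HamCycle-successor H H⇔ = v , (λ k _ → v< k) , v-injective , λ a b → mk⇔ (to a b) (from a b)
    where
    to : ∀ a b → H a b → ∃[ k ] (k < n × Adj (v k) (v (suc k % n)) a b)
    to a b h with Equivalence.to (H⇔ a b) h
    ... | x , x< , ad with reach< x x<
    ... | k , k< , refl = k , k< , subst (λ z → Adj (v k) z a b) (sym (v-next k k<)) ad
    from : ∀ a b → ∃[ k ] (k < n × Adj (v k) (v (suc k % n)) a b) → H a b
    from a b (k , k< , ad) = Equivalence.from (H⇔ a b) (v k , v< k , subst (λ z → Adj (v k) z a b) (v-next k k<) ad)

HamCycle-relabel : ∀ {n} .{{_ : NonZero n}} (g f : ℕ → ℕ) →
  (∀ a → a < n → g a < n) → (∀ p → p < n → f p < n) → (∀ p → p < n → g (f p) ≡ p) → (∀ a → a < n → f (g a) ≡ a) →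
  (H K : EdgeSet) → (∀ p q → K p q → p < n × q < n) →
  (∀ a b → a < n → b < n → H a b ⇔ K (g a) (g b)) → HamCycle n H → HamCycle n K
HamCycle-relabel {n} g f g< f< gf fg H K K-bounded H⇔K (v , v< , v-injective , H⇔) =
  (λ k → g (v k)) , (λ k k< → g< _ (v< k k<)) , gv-injective , λ p q → mk⇔ (to p q) (from p q)
  where
  gv-injective : ∀ k l → k < n → l < n → g (v k) ≡ g (v l) → k ≡ l
  gv-injective k l k< l< e = v-injective k l k< l< (trans (sym (fg _ (v< k k<))) (trans (cong f e) (fg _ (v< l l<))))
  to : ∀ p q → K p q → ∃[ k ] (k < n × Adj (g (v k)) (g (v (suc k % n))) p q)
  to p q kpq with K-bounded p q kpq
  ... | p< , q< with Equivalence.to (H⇔ (f p) (f q)) (Equivalence.from (H⇔K _ _ (f< p p<) (f< q q<)) (subst₂ K (sym (gf p p<)) (sym (gf q q<)) kpq))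
  ... | k , k< , ad = k , k< , subst₂ (Adj (g (v k)) (g (v (suc k % n)))) (gf p p<) (gf q q<) (Adj-map g ad)
  from : ∀ p q → ∃[ k ] (k < n × Adj (g (v k)) (g (v (suc k % n))) p q) → K p q
  from p q (k , k< , ad) with Equivalence.from (H⇔ _ _) (k , k< , inj₁ (refl , refl))
  ... | h with ad
  ... | inj₁ (refl , refl) = Equivalence.to (H⇔K _ _ (v< k k<) (v< _ (m%n<n (suc k) n))) h
  ... | inj₂ (refl , refl) = Equivalence.to (H⇔K _ _ (v< _ (m%n<n (suc k) n)) (v< k k<)) (Equivalence.from (H⇔ _ _) (k , k< , inj₂ (refl , refl)))

-- Pairings of a list

module _ {A : Set} (_≟_ : DecidableEquality A) where

  -- all ways of splitting a list into pairs; the fuel bounds the number of pairs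
  pairings : ℕ → List A → List (List (A × A))
  pairings _       []       = [] ∷ []
  pairings zero    (_ ∷ _)  = []
  pairings (suc f) (x ∷ xs) = concatMap (λ y → map ((x , y) ∷_) (pairings f (filter (λ z → ¬? (z ≟ y)) xs))) xs

  -- P lists the orbits of the involution μ on xs
  Traces : (A → A) → List A → List (A × A) → Set
  Traces μ xs P = All (λ ab → μ (proj₁ ab) ≡ proj₂ ab) P × (∀ {z} → z ∈ xs → Any (λ ab → proj₁ ab ≡ z ⊎ proj₂ ab ≡ z) P)

  pairings-complete : (μ : A → A) → (∀ x → μ (μ x) ≡ x) → (∀ x → μ x ≢ x) →
    ∀ f xs → length xs ≤ f → Unique xs → (∀ {x} → x ∈ xs → μ x ∈ xs) → Any (Traces μ xs) (pairings f xs)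
  pairings-complete μ μμ μ≢ _ [] _ _ _ = here ([] , λ ())
  pairings-complete μ μμ μ≢ (suc f) (x ∷ xs) len (x∉xs ∷ unique) closed =
    Anyₚ.concatMap⁺ _ (Any.map (λ { refl → Anyₚ.map⁺ (Any.map extend rest) }) μx∈xs)
    where
    y = μ x
    ys = filter (λ z → ¬? (z ≟ y)) xs

    μx∈xs : y ∈ xs
    μx∈xs with closed (here refl)
    ... | here e = ⊥-elim (μ≢ x e)
    ... | there i = i

    ys-closed : ∀ {z} → z ∈ ys → μ z ∈ ys
    ys-closed z∈ys with ∈-filter⁻ (λ z → ¬? (z ≟ y)) z∈ys
    ... | z∈xs , z≢y with closed (there z∈xs)
    ...   | here μz≡x = ⊥-elim (z≢y (trans (sym (μμ _)) (cong μ μz≡x)))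
    ...   | there μz∈xs = ∈-filter⁺ (λ z → ¬? (z ≟ y)) μz∈xs λ μz≡y →
              All.lookup x∉xs z∈xs (sym (trans (sym (μμ _)) (trans (cong μ μz≡y) (μμ x))))

    rest : Any (Traces μ ys) (pairings f ys)
    rest = pairings-complete μ μμ μ≢ f ys (≤-trans (length-filter _ xs) (s≤s⁻¹ len)) (Uniqueₚ.filter⁺ _ unique) ys-closed

    extend : ∀ {P} → Traces μ ys P → Traces μ (x ∷ xs) ((x , y) ∷ P)
    extend (pairs , covers) = refl ∷ pairs , cover
      where
      cover : ∀ {z} → z ∈ x ∷ xs → Any (λ ab → proj₁ ab ≡ z ⊎ proj₂ ab ≡ z) ((x , y) ∷ _)
      cover (here refl) = here (inj₁ refl)
      cover {z} (there z∈xs) with z ≟ y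
      ... | yes refl = here (inj₂ refl)
      ... | no z≢y = there (covers (∈-filter⁺ (λ z → ¬? (z ≟ y)) z∈xs z≢y))

-- The four paths

-- (k , true) is the first and (k , false) the last vertex of the k-th path of T ∖ R(S).
End : Set
End = Fin 4 × Bool

allEnds : List End
allEnds = (f0 , true) ∷ (f0 , false) ∷ (f1 , true) ∷ (f1 , false) ∷
          (f2 , true) ∷ (f2 , false) ∷ (f3 , true) ∷ (f3 , false) ∷ []

∈-allEnds : ∀ x → x ∈ allEnds
∈-allEnds (f0 , true)  = here refl
∈-allEnds (f0 , false) = there (here refl)
∈-allEnds (f1 , true)  = there (there (here refl))
∈-allEnds (f1 , false) = there (there (there (here refl)))
∈-allEnds (f2 , true)  = there (there (there (there (here refl))))
∈-allEnds (f2 , false) = there (there (there (there (there (here refl)))))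
∈-allEnds (f3 , true)  = there (there (there (there (there (there (here refl))))))
∈-allEnds (f3 , false) = there (there (there (there (there (there (there (here refl)))))))

next4 prev4 : Fin 4 → Fin 4
next4 f0 = f1
next4 f1 = f2
next4 f2 = f3
next4 f3 = f0
prev4 f0 = f3
prev4 f1 = f0
prev4 f2 = f1
prev4 f3 = f2

-- the other end of the removed tour edge at x
across : End → End
across (k , false) = next4 k , true
across (k , true)  = prev4 k , false

across-involutive : ∀ x → across (across x) ≡ x
across-involutive (f0 , true) = refl
across-involutive (f1 , true) = refl
across-involutive (f2 , true) = refl
across-involutive (f3 , true) = refl
across-involutive (f0 , false) = refl
across-involutive (f1 , false) = refl
across-involutive (f2 , false) = refl
across-involutive (f3 , false) = refl

-- The four paths are [0, e₀], [e₀+1, e₁], [e₁+1, e₂], [e₂+1, e₃], each with at least two vertices.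
module FourPaths (e₀ e₁ e₂ e₃ : ℕ) (h₀ : 0 < e₀) (h₁ : suc e₀ < e₁) (h₂ : suc e₁ < e₂) (h₃ : suc e₂ < e₃) where
  n : ℕ
  n = suc e₃

  first : Fin 4 → ℕ
  first f0 = 0
  first f1 = suc e₀
  first f2 = suc e₁
  first f3 = suc e₂

  last : Fin 4 → ℕ
  last f0 = e₀
  last f1 = e₁
  last f2 = e₂
  last f3 = e₃

  first<last : ∀ k → first k < last k
  first<last f0 = h₀
  first<last f1 = h₁
  first<last f2 = h₂
  first<last f3 = h₃

  private
    e₀<e₁ : e₀ < e₁
    e₀<e₁ = <-trans ≤-refl h₁
    e₁<e₂ : e₁ < e₂
    e₁<e₂ = <-trans ≤-refl h₂
    e₂<e₃ : e₂ < e₃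
    e₂<e₃ = <-trans ≤-refl h₃

    last≤e₃ : ∀ k → last k ≤ e₃
    last≤e₃ f0 = <⇒≤ (<-trans e₀<e₁ (<-trans e₁<e₂ e₂<e₃))
    last≤e₃ f1 = <⇒≤ (<-trans e₁<e₂ e₂<e₃)
    last≤e₃ f2 = <⇒≤ e₂<e₃
    last≤e₃ f3 = ≤-refl

  three≤n : 3 ≤ n
  three≤n = s≤s (≤-trans (s≤s h₀) (≤-trans (<⇒≤ h₁) (≤-trans (<⇒≤ e₁<e₂) (<⇒≤ e₂<e₃))))

  suc-last : ∀ k → k ≢ f3 → suc (last k) ≡ first (next4 k)
  suc-last f0 _ = refl
  suc-last f1 _ = refl
  suc-last f2 _ = refl
  suc-last f3 k≢ = ⊥-elim (k≢ refl)

  pos : End → ℕ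
  pos (k , true)  = first k
  pos (k , false) = last k

  inward : End → ℕ
  inward (k , true)  = suc (first k)
  inward (k , false) = pred (last k)

  InPath : Fin 4 → ℕ → Set
  InPath k p = first k ≤ p × p ≤ last k

  path : ℕ → Fin 4
  path p with p ≤? e₀
  ... | yes _ = f0
  ... | no _ with p ≤? e₁
  ... | yes _ = f1
  ... | no _ with p ≤? e₂
  ... | yes _ = f2
  ... | no _ = f3

  path-unique : ∀ k p → InPath k p → path p ≡ k
  path-unique f0 p (a , b) with p ≤? e₀
  ... | yes _ = refl
  ... | no q = ⊥-elim (q b)
  path-unique f1 p (a , b) with p ≤? e₀
  ... | yes q = ⊥-elim (<⇒≱ (n<1+n _) (≤-trans a q))
  ... | no _ with p ≤? e₁
  ... | yes _ = refl
  ... | no q = ⊥-elim (q b)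
  path-unique f2 p (a , b) with p ≤? e₀
  ... | yes q = ⊥-elim (<⇒≱ (<-trans e₀<e₁ (n<1+n e₁)) (≤-trans a q))
  ... | no _ with p ≤? e₁
  ... | yes q = ⊥-elim (<⇒≱ (n<1+n _) (≤-trans a q))
  ... | no _ with p ≤? e₂
  ... | yes _ = refl
  ... | no q = ⊥-elim (q b)
  path-unique f3 p (a , b) with p ≤? e₀
  ... | yes q = ⊥-elim (<⇒≱ (<-trans (<-trans e₀<e₁ e₁<e₂) (n<1+n e₂)) (≤-trans a q))
  ... | no _ with p ≤? e₁
  ... | yes q = ⊥-elim (<⇒≱ (<-trans e₁<e₂ (n<1+n e₂)) (≤-trans a q))
  ... | no _ with p ≤? e₂
  ... | yes q = ⊥-elim (<⇒≱ (n<1+n _) (≤-trans a q))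
  ... | no _ = refl

  InPath-path : ∀ p → p < n → InPath (path p) p
  InPath-path p p< with p ≤? e₀
  ... | yes q = z≤n , q
  ... | no q₀ with p ≤? e₁
  ... | yes q = ≰⇒> q₀ , q
  ... | no q₁ with p ≤? e₂
  ... | yes q = ≰⇒> q₁ , q
  ... | no q₂ = ≰⇒> q₂ , s≤s⁻¹ p<

  InPath-unique : ∀ k l p → InPath k p → InPath l p → k ≡ l
  InPath-unique k l p a b = trans (sym (path-unique k p a)) (path-unique l p b)

  InPath⇒< : ∀ k p → InPath k p → p < n
  InPath⇒< k p (_ , b) = s≤s (≤-trans b (last≤e₃ k))

  InPath-pos : ∀ x → InPath (proj₁ x) (pos x)
  InPath-pos (k , true)  = ≤-refl , <⇒≤ (first<last k)
  InPath-pos (k , false) = <⇒≤ (first<last k) , ≤-refl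

  InPath-inward : ∀ x → InPath (proj₁ x) (inward x)
  InPath-inward (k , true)  = n≤1+n _ , first<last k
  InPath-inward (k , false) = pred-mono-≤ (first<last k) , pred[n]≤n

  path-pos : ∀ x → path (pos x) ≡ proj₁ x
  path-pos x = path-unique _ _ (InPath-pos x)

  path-inward : ∀ x → path (inward x) ≡ proj₁ x
  path-inward x = path-unique _ _ (InPath-inward x)

  pos< : ∀ x → pos x < n
  pos< x = InPath⇒< _ _ (InPath-pos x)

  pos-injective : ∀ x y → pos x ≡ pos y → x ≡ y
  pos-injective (k , b) (l , c) e with InPath-unique k l _ (InPath-pos (k , b)) (subst (InPath l) (sym e) (InPath-pos (l , c)))
  pos-injective (k , true)  (.k , true)  e | refl = refl
  pos-injective (k , false) (.k , false) e | refl = refl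
  pos-injective (k , true)  (.k , false) e | refl = ⊥-elim (<-irrefl e (first<last k))
  pos-injective (k , false) (.k , true)  e | refl = ⊥-elim (<-irrefl (sym e) (first<last k))

  end? : ∀ p → (∃[ x ] (p ≡ pos x)) ⊎ (∀ x → p ≢ pos x)
  end? p with Any.any? (λ x → p ≟ pos x) allEnds
  ... | yes found = inj₁ (Any.lookup found , Anyₚ.lookup-result found)
  ... | no none = inj₂ λ x e → none (Any.map (λ { refl → e }) (∈-allEnds x))

  -- {y , y+1} is an edge of one of the four paths
  Inner : ℕ → Set
  Inner y = y < e₃ × y ≢ e₀ × y ≢ e₁ × y ≢ e₂

  Paths : EdgeSet
  Paths p q = ∃[ y ] (Inner y × Adj y (suc y) p q)

  Inner-last : ∀ y → Inner y → ∀ k → y ≢ last k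
  Inner-last y (a , b , c , d) f0 = b
  Inner-last y (a , b , c , d) f1 = c
  Inner-last y (a , b , c , d) f2 = d
  Inner-last y (a , b , c , d) f3 = <⇒≢ a

  Inner-intro : ∀ y → y < n → (∀ k → y ≢ last k) → Inner y
  Inner-intro y y< ne = ≤∧≢⇒< (s≤s⁻¹ y<) (ne f3) , ne f0 , ne f1 , ne f2

  InPath-suc : ∀ k y → InPath k y → y ≢ last k → InPath k (suc y)
  InPath-suc k y (a , b) ne = ≤-trans a (n≤1+n y) , ≤∧≢⇒< b ne

  Paths-sym : ∀ p q → Paths p q → Paths q p
  Paths-sym p q (y , inner , ad) = y , inner , Adj-swap ad

  Paths-path : ∀ p q → Paths p q → path p ≡ path q
  Paths-path p q (y , inner , inj₁ (refl , refl)) = sym (path-unique _ _ (InPath-suc _ y (InPath-path y (<-trans (proj₁ inner) ≤-refl)) (Inner-last y inner _)))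
  Paths-path p q (y , inner , inj₂ (refl , refl)) = path-unique _ _ (InPath-suc _ y (InPath-path y (<-trans (proj₁ inner) ≤-refl)) (Inner-last y inner _))

  Paths-bounded : ∀ p q → Paths p q → p < n × q < n
  Paths-bounded p q (y , inner , inj₁ (refl , refl)) = <-trans (proj₁ inner) ≤-refl , s≤s (proj₁ inner)
  Paths-bounded p q (y , inner , inj₂ (refl , refl)) = s≤s (proj₁ inner) , <-trans (proj₁ inner) ≤-refl

  first≢last : ∀ k l → first k ≢ last l
  first≢last k l e with refl ← InPath-unique k l _ (InPath-pos (k , true)) (subst (InPath l) (sym e) (InPath-pos (l , false))) =
    <-irrefl e (first<last k)

  pred< : ∀ {a b} → a < b → pred b < b
  pred< {b = suc b} _ = ≤-refl

  suc-pred< : ∀ {a b} → a < b → suc (pred b) ≡ b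
  suc-pred< {b = suc b} _ = refl

  Paths-inward : ∀ x → Paths (pos x) (inward x)
  Paths-inward (k , true) =
    first k , Inner-intro _ (<-trans (first<last k) (InPath⇒< k _ (InPath-pos (k , false)))) (first≢last k) , inj₁ (refl , refl)
  Paths-inward (k , false) =
    pred (last k) , Inner-intro _ (<-trans (pred< (first<last k)) (InPath⇒< k _ (InPath-pos (k , false)))) ne , inj₂ (sym (suc-pred< (first<last k)) , refl)
    where
    ne : ∀ l → pred (last k) ≢ last l
    ne l e with refl ← InPath-unique k l _ (InPath-inward (k , false)) (subst (InPath l) (sym e) (InPath-pos (l , false))) =
      <-irrefl e (pred< (first<last k))

  Paths-end : ∀ x b → Paths (pos x) b → b ≡ inward x
  Paths-end (k , true) b (y , inner , inj₁ (refl , refl)) = refl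
  Paths-end (f0 , true) b (y , inner , inj₂ (() , refl))
  Paths-end (f1 , true) b (y , inner , inj₂ (e , refl)) = ⊥-elim (Inner-last y inner f0 (suc-injective (sym e)))
  Paths-end (f2 , true) b (y , inner , inj₂ (e , refl)) = ⊥-elim (Inner-last y inner f1 (suc-injective (sym e)))
  Paths-end (f3 , true) b (y , inner , inj₂ (e , refl)) = ⊥-elim (Inner-last y inner f2 (suc-injective (sym e)))
  Paths-end (k , false) b (y , inner , inj₁ (refl , refl)) = ⊥-elim (Inner-last _ inner k refl)
  Paths-end (k , false) b (y , inner , inj₂ (e , refl)) = cong pred (sym e)

  Paths-interior : ∀ p → p < n → (∀ x → p ≢ pos x) → Paths p (pred p) × Paths p (suc p) × pred p ≢ suc p
  Paths-interior p p< not-end =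
    (pred p , Inner-intro _ (≤-<-trans pred[n]≤n p<) ne , inj₂ (sym (suc-pred< 0<p) , refl)) ,
    (p , Inner-intro _ p< (λ k e → not-end (k , false) e) , inj₁ (refl , refl)) ,
    (λ e → <-irrefl e (s≤s pred[n]≤n))
    where
    0<p : 0 < p
    0<p = ≤∧≢⇒< z≤n (λ e → not-end (f0 , true) (sym e))
    ne : ∀ k → pred p ≢ last k
    ne k e with k ≟ᶠ f3
    ... | yes refl = <-irrefl refl (<-≤-trans (subst (_< p) e (pred< 0<p)) (s≤s⁻¹ p<))
    ... | no k≢f3 = not-end (next4 k , true) (trans (sym (suc-pred< 0<p)) (trans (cong suc e) (suc-last k k≢f3)))

  Joins : List (End × End) → EdgeSet
  Joins P p q = Any (λ uw → Adj (pos (proj₁ uw)) (pos (proj₂ uw)) p q) P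

  Inner-InPath : ∀ k y → InPath k y → y ≢ last k → Inner y
  Inner-InPath k y iy y≢ = Inner-intro y (InPath⇒< k y iy) λ l e →
    y≢ (trans e (cong last (InPath-unique l k y (subst (InPath l) (sym e) (InPath-pos (l , false))) iy)))

-- Reinsertion schemes

_≟ₑ_ : DecidableEquality End
_≟ₑ_ = ≡-dec _≟ᶠ_ _≟ᵇ_

-- After path k the tour continues with path (next k), traversed from first to last vertex iff forward.
record Scheme : Set where
  field
    next    : Fin 4 → Fin 4
    forward : Fin 4 → Bool

  entry exit : Fin 4 → End
  entry k = k , forward k
  exit  k = k , not (forward k)

  link : Fin 4 → End × End
  link k = exit k , entry (next k)

  links : List (End × End)
  links = tabulate link

  Pure : Set
  Pure = ∀ k → entry (next k) ≢ across (exit k)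

  pure? : Dec Pure
  pure? = all? λ k → ¬? (entry (next k) ≟ₑ across (exit k))

open Scheme public

exit≢entry : ∀ σ k l → exit σ k ≢ entry σ l
exit≢entry σ k l e with refl ← cong proj₁ e = not-¬ refl (sym (cong proj₂ e))

-- the scheme visiting path 0 forwards and then the signed paths a, b, c
signed : Fin 4 × Fin 4 × Fin 4 → Bool × Bool × Bool → Scheme
signed (a , b , c) (da , db , dc) = record { next = nxt ; forward = fwd }
  where
  _==_ : Fin 4 → Fin 4 → Bool
  k == l = does (k ≟ᶠ l)
  nxt : Fin 4 → Fin 4
  nxt f0 = a
  nxt k = if k == a then b else if k == b then c else f0
  fwd : Fin 4 → Bool
  fwd f0 = true
  fwd k = if k == a then da else if k == b then db else dc

orders : List (Fin 4 × Fin 4 × Fin 4)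
orders = (f1 , f2 , f3) ∷ (f1 , f3 , f2) ∷ (f2 , f1 , f3) ∷ (f2 , f3 , f1) ∷ (f3 , f1 , f2) ∷ (f3 , f2 , f1) ∷ []

signs : List (Bool × Bool × Bool)
signs = cartesianProduct bools (cartesianProduct bools bools)
  where
  bools : List Bool
  bools = true ∷ false ∷ []

pureSchemes : List Scheme
pureSchemes = filter pure? (concatMap (λ o → map (signed o) signs) orders)

-- the conditions under which a scheme yields a pure reinsertion set
Valid : Scheme → Set
Valid σ = Pure σ × (∀ k l → next σ k ≡ next σ l → k ≡ l) × (∀ k → ∃[ j ] (fold f0 (next σ) (toℕ {4} j) ≡ k))

valid? : ∀ σ → Dec (Valid σ)
valid? σ = pure? σ ×-dec all? (λ k → all? λ l → (next σ k ≟ᶠ next σ l) →-dec (k ≟ᶠ l)) ×-dec all? (λ k → any? λ j → fold f0 (next σ) (toℕ j) ≟ᶠ k)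

pureSchemes-valid : All Valid pureSchemes
pureSchemes-valid = from-yes (All.all? valid? pureSchemes)

-- Walking each path in its direction and jumping along the links traces a single cycle through all vertices.
module SchemeCycle (e₀ e₁ e₂ e₃ : ℕ) (h₀ : 0 < e₀) (h₁ : suc e₀ < e₁) (h₂ : suc e₁ < e₂) (h₃ : suc e₂ < e₃)
  (σ : Scheme) (next-injective : ∀ k l → next σ k ≡ next σ l → k ≡ l)
  (next-cyclic : ∀ k → ∃[ j ] (fold f0 (next σ) j ≡ k)) where
  open FourPaths e₀ e₁ e₂ e₃ h₀ h₁ h₂ h₃

  private
    step : Fin 4 → ℕ → ℕ
    step k p = if forward σ k then suc p else pred p

    direction : ∀ k → forward σ k ≡ true ⊎ forward σ k ≡ false
    direction k with forward σ k
    ... | true = inj₁ refl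
    ... | false = inj₂ refl

    exit-fwd : ∀ {k} → forward σ k ≡ true → pos (exit σ k) ≡ last k
    exit-fwd {k} d rewrite d = refl
    exit-bwd : ∀ {k} → forward σ k ≡ false → pos (exit σ k) ≡ first k
    exit-bwd {k} d rewrite d = refl
    entry-fwd : ∀ {k} → forward σ k ≡ true → pos (entry σ k) ≡ first k
    entry-fwd {k} d rewrite d = refl
    entry-bwd : ∀ {k} → forward σ k ≡ false → pos (entry σ k) ≡ last k
    entry-bwd {k} d rewrite d = refl
    step-fwd : ∀ {k} p → forward σ k ≡ true → step k p ≡ suc p
    step-fwd {k} p d rewrite d = refl
    step-bwd : ∀ {k} p → forward σ k ≡ false → step k p ≡ pred p
    step-bwd {k} p d rewrite d = refl

  s : ℕ → ℕ
  s p with p ≟ pos (exit σ (path p))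
  ... | yes _ = pos (entry σ (next σ (path p)))
  ... | no _ = step (path p) p

  s-exit : ∀ k → s (pos (exit σ k)) ≡ pos (entry σ (next σ k))
  s-exit k with pos (exit σ k) ≟ pos (exit σ (path (pos (exit σ k))))
  ... | yes _ = cong (λ z → pos (entry σ (next σ z))) (path-pos (exit σ k))
  ... | no ne = ⊥-elim (ne (cong (λ z → pos (exit σ z)) (sym (path-pos (exit σ k)))))

  s-step : ∀ k p → InPath k p → p ≢ pos (exit σ k) → s p ≡ step k p
  s-step k p ip ne with refl ← path-unique k p ip with p ≟ pos (exit σ (path p))
  ... | yes e = ⊥-elim (ne e)
  ... | no _ = refl

  step-InPath : ∀ k p → InPath k p → p ≢ pos (exit σ k) → InPath k (step k p) × step k p ≢ pos (entry σ k)
  step-InPath k p (a , b) ne with forward σ k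
  ... | true = (≤-trans a (n≤1+n p) , ≤∧≢⇒< b ne) , λ e → <-irrefl (sym e) (s≤s a)
  ... | false = (pred-mono-≤ first<p , ≤-trans pred[n]≤n b) , λ e → <-irrefl e (<-≤-trans (pred< first<p) b)
    where
    first<p : first k < p
    first<p = ≤∧≢⇒< a (λ e → ne (sym e))

  s< : ∀ p → p < n → s p < n
  s< p p< with p ≟ pos (exit σ (path p))
  ... | yes _ = pos< (entry σ (next σ (path p)))
  ... | no ne = InPath⇒< _ _ (proj₁ (step-InPath _ p (InPath-path p p<) ne))

  step-injective : ∀ k p q → InPath k p → InPath k q → p ≢ pos (exit σ k) → q ≢ pos (exit σ k) → step k p ≡ step k q → p ≡ q
  step-injective k p q (ap , _) (aq , _) np nq e with forward σ k
  ... | true = suc-injective e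
  ... | false = pred-injective′ (≤∧≢⇒< ap (λ z → np (sym z))) (≤∧≢⇒< aq (λ z → nq (sym z))) e
    where
    pred-injective′ : ∀ {a p q} → a < p → a < q → pred p ≡ pred q → p ≡ q
    pred-injective′ {p = suc p} {q = suc q} _ _ e = cong suc e

  s-injective : ∀ p q → p < n → q < n → s p ≡ s q → p ≡ q
  s-injective p q p< q< e with p ≟ pos (exit σ (path p)) | q ≟ pos (exit σ (path q))
  ... | yes ep | yes eq =
    trans ep (trans (cong (λ z → pos (exit σ z)) (next-injective _ _ (cong proj₁ (pos-injective (entry σ (next σ (path p))) (entry σ (next σ (path q))) e)))) (sym eq))
  ... | yes ep | no nq with step-InPath _ q (InPath-path q q<) nq
  ...   | iq , q≢ = ⊥-elim (q≢ (trans (sym e) (cong (λ z → pos (entry σ z)) (InPath-unique _ _ _ (InPath-pos (entry σ _)) (subst (InPath _) (sym e) iq)))))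
  s-injective p q p< q< e | no np | yes eq with step-InPath _ p (InPath-path p p<) np
  ...   | ip , p≢ = ⊥-elim (p≢ (trans e (cong (λ z → pos (entry σ z)) (InPath-unique _ _ _ (InPath-pos (entry σ _)) (subst (InPath _) e ip)))))
  s-injective p q p< q< e | no np | no nq with step-InPath _ p (InPath-path p p<) np | step-InPath _ q (InPath-path q q<) nq
  ...   | ip , _ | iq , _ with InPath-unique _ _ _ ip (subst (InPath _) (sym e) iq)
  ...   | same = step-injective _ p q (InPath-path p p<) (subst (λ k → InPath k q) (sym same) (InPath-path q q<)) np
                   (subst (λ k → q ≢ pos (exit σ k)) (sym same) nq) (trans e (cong (λ k → step k q) (sym same)))

  Cycle : EdgeSet
  Cycle p q = Paths p q ⊎ Joins (links σ) p q

  Cycle-from-s : ∀ a b → ∃[ x ] (x < n × Adj x (s x) a b) → Cycle a b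
  Cycle-from-s a b (x , x< , ad) with x ≟ pos (exit σ (path x))
  ... | yes ex = inj₂ (Anyₚ.tabulate⁺ {f = link σ} (path x) (subst (λ z → Adj z (pos (entry σ (next σ (path x)))) a b) ex ad))
  ... | no nx with direction (path x)
  ...   | inj₁ d = inj₁ (x , Inner-InPath k x ix (λ e → nx (trans e (sym (exit-fwd d)))) ,
                          subst (λ z → Adj x z a b) (step-fwd x d) ad)
    where
    k = path x
    ix = InPath-path x x<
  ...   | inj₂ d = inj₁ (pred x , Inner-InPath k (pred x) (pred-mono-≤ first<x , ≤-trans pred[n]≤n (proj₂ ix)) (λ e → <-irrefl e (<-≤-trans (pred< first<x) (proj₂ ix))) ,
                          subst (λ z → Adj (pred x) z a b) (sym (suc-pred< first<x)) (Adj-flip (subst (λ z → Adj x z a b) (step-bwd x d) ad)))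
    where
    k = path x
    ix = InPath-path x x<
    first<x : first k < x
    first<x = ≤∧≢⇒< (proj₁ ix) (λ e → nx (trans (sym e) (sym (exit-bwd d))))

  Cycle-to-s : ∀ a b → Cycle a b → ∃[ x ] (x < n × Adj x (s x) a b)
  Cycle-to-s a b (inj₂ j) with Anyₚ.tabulate⁻ {f = link σ} j
  ... | k , ad = pos (exit σ k) , pos< (exit σ k) , subst (λ z → Adj (pos (exit σ k)) z a b) (sym (s-exit k)) ad
  Cycle-to-s a b (inj₁ (y , inner , ad)) with direction (path y)
  ... | inj₁ d = y , y< , subst (λ z → Adj y z a b) (sym (trans (s-step k y iy (λ e → Inner-last y inner k (trans e (exit-fwd d)))) (step-fwd y d))) ad
    where
    y< = proj₁ (Paths-bounded _ _ (y , inner , inj₁ (refl , refl)))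
    k = path y
    iy = InPath-path y y<
  ... | inj₂ d = suc y , sy< , subst (λ z → Adj (suc y) z a b) (sym (trans (s-step k (suc y) isy sy≢exit) (step-bwd (suc y) d))) (Adj-flip ad)
    where
    y< = proj₁ (Paths-bounded _ _ (y , inner , inj₁ (refl , refl)))
    sy< = proj₂ (Paths-bounded _ _ (y , inner , inj₁ (refl , refl)))
    k = path y
    iy = InPath-path y y<
    isy : InPath k (suc y)
    isy = InPath-suc k y iy (Inner-last y inner k)
    sy≢exit : suc y ≢ pos (exit σ k)
    sy≢exit e = <-irrefl (sym (trans e (exit-bwd d))) (s≤s (proj₁ iy))

  private
    x₀ : ℕ
    x₀ = pos (entry σ f0)

    Reached : ℕ → Set
    Reached y = ∃[ j ] (fold x₀ s j ≡ y)

    reached-step : ∀ a → Reached a → ∀ t → Reached (fold a s t)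
    reached-step a (j , e) t = t + j , trans (fold-+ x₀ s t) (cong (λ z → fold z s t) e)

    walk-forward : ∀ k → forward σ k ≡ true → ∀ t → first k + t ≤ last k → fold (first k) s t ≡ first k + t
    walk-forward k d zero _ = sym (+-identityʳ _)
    walk-forward k d (suc t) le = begin
      s (fold (first k) s t)  ≡⟨ cong s (walk-forward k d t (<⇒≤ lt)) ⟩
      s (first k + t)         ≡⟨ s-step k _ (m≤m+n _ _ , <⇒≤ lt) (λ e → <-irrefl (trans e (exit-fwd d)) lt) ⟩
      step k (first k + t)    ≡⟨ step-fwd _ d ⟩
      suc (first k + t)       ≡⟨ sym (+-suc _ t) ⟩
      first k + suc t         ∎
      where
      open ≡-Reasoning
      lt : first k + t < last k
      lt = subst (_≤ last k) (+-suc _ t) le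

    walk-backward : ∀ k → forward σ k ≡ false → ∀ t → t ≤ last k ∸ first k → fold (last k) s t ≡ last k ∸ t
    walk-backward k d zero _ = refl
    walk-backward k d (suc t) le = begin
      s (fold (last k) s t)  ≡⟨ cong s (walk-backward k d t (<⇒≤ le)) ⟩
      s (last k ∸ t)         ≡⟨ s-step k _ (<⇒≤ first< , m∸n≤m _ t) (λ e → <-irrefl (sym (trans e (exit-bwd d))) first<) ⟩
      step k (last k ∸ t)    ≡⟨ step-bwd _ d ⟩
      pred (last k ∸ t)      ≡⟨ pred[m∸n]≡m∸[1+n] (last k) t ⟩
      last k ∸ suc t         ∎
      where
      open ≡-Reasoning
      first< : first k < last k ∸ t
      first< = subst (_< last k ∸ t) (m∸[m∸n]≡n (<⇒≤ (first<last k))) (∸-monoʳ-< le (m∸n≤m (last k) (first k)))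

    reached-path : ∀ k → Reached (pos (entry σ k)) → (∀ p → InPath k p → Reached p) × Reached (pos (exit σ k))
    reached-path k r with direction k
    ... | inj₁ d = (λ p ip → subst Reached (along p ip) (reached-step _ r (p ∸ first k))) ,
                   subst Reached (trans (along (last k) (<⇒≤ (first<last k) , ≤-refl)) (sym (exit-fwd d))) (reached-step _ r (last k ∸ first k))
      where
      along : ∀ p → InPath k p → fold (pos (entry σ k)) s (p ∸ first k) ≡ p
      along p (a , b) = trans (cong (λ z → fold z s (p ∸ first k)) (entry-fwd d))
                          (trans (walk-forward k d (p ∸ first k) (subst (_≤ last k) (sym (m+[n∸m]≡n a)) b)) (m+[n∸m]≡n a))
    ... | inj₂ d = (λ p ip → subst Reached (along p ip) (reached-step _ r (last k ∸ p))) ,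
                   subst Reached (trans (along (first k) (≤-refl , <⇒≤ (first<last k))) (sym (exit-bwd d))) (reached-step _ r (last k ∸ first k))
      where
      along : ∀ p → InPath k p → fold (pos (entry σ k)) s (last k ∸ p) ≡ p
      along p (a , b) = trans (cong (λ z → fold z s (last k ∸ p)) (entry-bwd d))
                          (trans (walk-backward k d (last k ∸ p) (∸-monoʳ-≤ (last k) a)) (m∸[m∸n]≡n b))

    reached-entry : ∀ j → Reached (pos (entry σ (fold f0 (next σ) j)))
    reached-entry zero = 0 , refl
    reached-entry (suc j) = subst Reached (s-exit _) (reached-step _ (proj₂ (reached-path _ (reached-entry j))) 1)

    reached : ∀ y → y < n → Reached y
    reached y y< with next-cyclic (path y)
    ... | j , e = proj₁ (reached-path (path y) (subst (λ z → Reached (pos (entry σ z))) e (reached-entry j))) y (InPath-path y y<)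

  HamCycle-scheme : HamCycle n Cycle
  HamCycle-scheme = CyclicSuccessor.HamCycle-successor e₃ s x₀ s< s-injective (pos< (entry σ f0)) reached Cycle
    (λ a b → mk⇔ (Cycle-to-s a b) (Cycle-from-s a b))

_∈ₑ?_ : ∀ (l : End × End) P → Dec (l ∈ P)
_∈ₑ?_ = DecMembership._∈?_ (≡-dec _≟ₑ_ _≟ₑ_)

-- the 105 pairings of the eight ends
candidates : List (List (End × End))
candidates = pairings _≟ₑ_ 8 allEnds

Crosses : List (End × End) → Set
Crosses P = Any (λ ab → proj₂ ab ≡ across (proj₁ ab)) P

-- some proper set C of paths, containing path 0, is a union of components
Splits : List (End × End) → Set
Splits P = ∃[ C ] (Vec.lookup C f0 ≡ true × (∃[ l ] Vec.lookup C l ≡ false) ×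
                   All (λ ab → Vec.lookup C (proj₁ (proj₁ ab)) ≡ Vec.lookup C (proj₁ (proj₂ ab))) P)

Realises : List (End × End) → Scheme → Set
Realises P σ = ∀ k → link σ k ∈ P ⊎ swap (link σ k) ∈ P

Outcome : List (End × End) → Set
Outcome P = Crosses P ⊎ Splits P ⊎ Any (Realises P) pureSchemes

outcome? : ∀ P → Dec (Outcome P)
outcome? P = Any.any? (λ ab → proj₂ ab ≟ₑ across (proj₁ ab)) P
        ⊎-dec anySubset? (λ C → (Vec.lookup C f0 ≟ᵇ true) ×-dec any? (λ l → Vec.lookup C l ≟ᵇ false) ×-dec
                                All.all? (λ ab → Vec.lookup C (proj₁ (proj₁ ab)) ≟ᵇ Vec.lookup C (proj₁ (proj₂ ab))) P)
        ⊎-dec Any.any? (λ σ → all? (λ k → (link σ k ∈ₑ? P) ⊎-dec (swap (link σ k) ∈ₑ? P))) pureSchemes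

-- decided by evaluation; opaque, so that the evidence is never unfolded again
opaque
  classification : All Outcome candidates
  classification = from-yes (All.all? outcome? candidates)

Connects : (End → End) → Set
Connects μ = ∀ (C : Fin 4 → Bool) → (∀ x → C (proj₁ x) ≡ true → C (proj₁ (μ x)) ≡ true) → C f0 ≡ true → ∀ l → C l ≡ true

module _ (μ : End → End) (μμ : ∀ x → μ (μ x) ≡ x) (μ≢ : ∀ x → μ x ≢ x) (μ-pure : ∀ x → μ x ≢ across x) (μ-connected : Connects μ) where

  opaque
    scheme-of-pairing : ∃[ σ ] (σ ∈ pureSchemes × ∀ k → μ (exit σ k) ≡ entry σ (next σ k))
    scheme-of-pairing with find (pairings-complete _≟ₑ_ μ μμ μ≢ 8 allEnds ≤-refl (from-yes (DecUnique.unique? _≟ₑ_ allEnds)) (λ _ → ∈-allEnds _))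
    ... | P , P∈ , pairs , covers with All.lookup classification P∈
    ...   | inj₁ crossing with find crossing
    ...     | (a , b) , ab∈P , b≡ = ⊥-elim (μ-pure a (trans (All.lookup pairs ab∈P) b≡))
    scheme-of-pairing | P , P∈ , pairs , covers | inj₂ (inj₁ (C , C0 , (l , Cl) , C-closed)) =
      ⊥-elim (not-¬ {true} refl (trans (sym (μ-connected (Vec.lookup C) μ-closed C0 l)) Cl))
      where
      μ-closed : ∀ x → Vec.lookup C (proj₁ x) ≡ true → Vec.lookup C (proj₁ (μ x)) ≡ true
      μ-closed x Cx with find (covers (∈-allEnds x))
      ... | (a , b) , ab∈P , inj₁ refl = trans (cong (λ z → Vec.lookup C (proj₁ z)) (All.lookup pairs ab∈P)) (trans (sym (All.lookup C-closed ab∈P)) Cx)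
      ... | (a , b) , ab∈P , inj₂ refl =
        trans (cong (λ z → Vec.lookup C (proj₁ z)) (trans (cong μ (sym (All.lookup pairs ab∈P))) (μμ a))) (trans (All.lookup C-closed ab∈P) Cx)
    scheme-of-pairing | P , P∈ , pairs , covers | inj₂ (inj₂ realised) with find realised
    ... | σ , σ∈ , links∈P = σ , σ∈ , λ k → linked k (links∈P k)
      where
      linked : ∀ k → link σ k ∈ P ⊎ swap (link σ k) ∈ P → μ (exit σ k) ≡ entry σ (next σ k)
      linked k (inj₁ ∈P) = All.lookup pairs ∈P
      linked k (inj₂ ∈P) = trans (cong μ (sym (All.lookup pairs ∈P))) (μμ _)

module CycleScheme (e₀ e₁ e₂ e₃ : ℕ) (h₀ : 0 < e₀) (h₁ : suc e₀ < e₁) (h₂ : suc e₁ < e₂) (h₃ : suc e₂ < e₃)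
  (X : EdgeSet)
  (X-bounded : ∀ p q → X p q → p < suc e₃ × q < suc e₃)
  (X-sym : ∀ p q → X p q → X q p)
  (X-pure : ∀ x → ¬ X (FourPaths.pos e₀ e₁ e₂ e₃ h₀ h₁ h₂ h₃ x) (FourPaths.pos e₀ e₁ e₂ e₃ h₀ h₁ h₂ h₃ (across x)))
  (ham : HamCycle (suc e₃) (λ p q → FourPaths.Paths e₀ e₁ e₂ e₃ h₀ h₁ h₂ h₃ p q ⊎ X p q)) where
  open FourPaths e₀ e₁ e₂ e₃ h₀ h₁ h₂ h₃

  Cycle : EdgeSet
  Cycle p q = Paths p q ⊎ X p q

  open HamiltonianCycle e₃ Cycle ham

  private
    inward-edge : ∀ x → Cycle (pos x) (inward x)
    inward-edge x = inj₁ (Paths-inward x)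

    two≤n : 2 ≤ n
    two≤n = ≤-trans (n≤1+n 2) three≤n

  -- the second cycle edge at an end leaves through X to another end
  Joined : End → End → Set
  Joined x y = X (pos x) (pos y) × pos y ≢ inward x

  joined : ∀ x → ∃[ y ] (Joined x y)
  joined x with degree≥2 three≤n (pos x) (inward x) (inward-edge x)
  ... | c , inj₁ path-edge , c≢ = ⊥-elim (c≢ (Paths-end x c path-edge))
  ... | c , inj₂ xc , c≢ with end? c
  ...   | inj₁ (y , refl) = y , xc , c≢
  ...   | inj₂ not-end with Paths-interior c (proj₂ (X-bounded _ _ xc)) not-end
  ...     | to-pred , to-suc , pred≢suc with degree≤2 c (pred c) (suc c) (pos x) (inj₁ to-pred) (inj₁ to-suc) (H-sym _ _ (inj₂ xc))
  ...       | inj₁ e = ⊥-elim (pred≢suc e)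
  ...       | inj₂ (inj₁ e) = ⊥-elim (c≢ (Paths-end x c (Paths-sym _ _ (subst (Paths c) e to-pred))))
  ...       | inj₂ (inj₂ e) = ⊥-elim (c≢ (Paths-end x c (Paths-sym _ _ (subst (Paths c) e to-suc))))

  private
    pos≢inward : ∀ x → pos x ≢ inward x
    pos≢inward x e = irreflexive two≤n (pos x) (subst (Cycle (pos x)) (sym e) (inward-edge x))

    Joined-unique : ∀ x y z → Joined x y → Joined x z → y ≡ z
    Joined-unique x y z (xy , y≢) (xz , z≢) with degree≤2 (pos x) (inward x) (pos y) (pos z) (inward-edge x) (inj₂ xy) (inj₂ xz)
    ... | inj₁ e = ⊥-elim (y≢ (sym e))
    ... | inj₂ (inj₁ e) = ⊥-elim (z≢ (sym e))
    ... | inj₂ (inj₂ e) = pos-injective y z e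

    Joined-sym : ∀ x y → Joined x y → Joined y x
    Joined-sym (k , b) (l , c) (xy , y≢) = X-sym _ _ xy , x≢
      where
      x≢ : pos (k , b) ≢ inward (l , c)
      x≢ e with refl ← InPath-unique k l _ (InPath-pos (k , b)) (subst (InPath l) (sym e) (InPath-inward (l , c))) = same-path b c e y≢
        where
        same-path : ∀ b c → pos (k , b) ≡ inward (k , c) → pos (k , c) ≢ inward (k , b) → ⊥
        same-path true true e _ = pos≢inward (k , true) e
        same-path false false e _ = pos≢inward (k , false) e
        same-path true false e y≢ = y≢ (trans (sym (suc-pred< (first<last k))) (cong suc (sym e)))
        same-path false true e y≢ = y≢ (cong pred (sym e))

  μ : End → End
  μ x = proj₁ (joined x)

  μ-joined : ∀ x → Joined x (μ x)
  μ-joined x = proj₂ (joined x)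

  μ-involutive : ∀ x → μ (μ x) ≡ x
  μ-involutive x = sym (Joined-unique (μ x) x (μ (μ x)) (Joined-sym x (μ x) (μ-joined x)) (μ-joined (μ x)))

  μ≢ : ∀ x → μ x ≢ x
  μ≢ x e = irreflexive two≤n (pos x) (inj₂ (subst (λ z → X (pos x) (pos z)) e (proj₁ (μ-joined x))))

  μ-pure : ∀ x → μ x ≢ across x
  μ-pure x e = X-pure x (subst (λ z → X (pos x) (pos z)) e (proj₁ (μ-joined x)))

  -- a set of paths closed under μ contains the path of every cycle neighbour of its vertices
  μ-connected : Connects μ
  μ-connected C closed C0 l = subst (λ z → C z ≡ true) (path-pos (l , true))
    (connected P P-closed (pos (f0 , true)) (inward (f0 , true)) (inward-edge (f0 , true)) (subst (λ z → C z ≡ true) (sym (path-pos (f0 , true))) C0)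
               (pos (l , true)) (inward (l , true)) (inward-edge (l , true)))
    where
    P : ℕ → Set
    P p = C (path p) ≡ true
    P-closed : ∀ a b → Cycle a b → P a → P b
    P-closed a b (inj₁ t) pa = subst (λ z → C z ≡ true) (Paths-path a b t) pa
    P-closed a b (inj₂ xab) pa with end? a
    ... | inj₁ (x , refl) with degree≤2 (pos x) (inward x) (pos (μ x)) b (inward-edge x) (inj₂ (proj₁ (μ-joined x))) (inj₂ xab)
    ...   | inj₁ e = ⊥-elim (proj₂ (μ-joined x) (sym e))
    ...   | inj₂ (inj₁ e) = subst (λ z → C z ≡ true) (trans (sym (path-inward x)) (cong path e)) (subst (λ z → C z ≡ true) (path-pos x) pa)
    ...   | inj₂ (inj₂ e) = subst (λ z → C z ≡ true) (trans (sym (path-pos (μ x))) (cong path e)) (closed x (subst (λ z → C z ≡ true) (path-pos x) pa))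
    P-closed a b (inj₂ xab) pa | inj₂ not-end with Paths-interior a (proj₁ (X-bounded _ _ xab)) not-end
    ... | to-pred , to-suc , pred≢suc with degree≤2 a (pred a) (suc a) b (inj₁ to-pred) (inj₁ to-suc) (inj₂ xab)
    ...   | inj₁ e = ⊥-elim (pred≢suc e)
    ...   | inj₂ (inj₁ e) = subst (λ z → C z ≡ true) (Paths-path a b (subst (Paths a) e to-pred)) pa
    ...   | inj₂ (inj₂ e) = subst (λ z → C z ≡ true) (Paths-path a b (subst (Paths a) e to-suc)) pa

  opaque
    scheme-of-cycle : ∃[ σ ] (σ ∈ pureSchemes × ∀ k → μ (exit σ k) ≡ entry σ (next σ k))
    scheme-of-cycle = scheme-of-pairing μ μ-involutive μ≢ μ-pure μ-connected

  X-links : AtMost4Edges X → ∃[ σ ] (σ ∈ pureSchemes × ∀ p q → X p q ⇔ Joins (links σ) p q)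
  X-links four with scheme-of-cycle
  ... | σ , σ∈ , μ-exit = σ , σ∈ , λ p q → mk⇔ (to p q) (from p q)
    where
    f : Fin 4 → ℕ × ℕ
    f i = pos (exit σ i) , pos (entry σ (next σ i))
    f-X : ∀ i → X (proj₁ (f i)) (proj₂ (f i))
    f-X i = subst (λ z → X (pos (exit σ i)) (pos z)) (μ-exit i) (proj₁ (μ-joined (exit σ i)))
    f-distinct : ∀ i j → SameEdge (f i) (f j) → i ≡ j
    f-distinct i j (inj₁ (e , _)) = sym (cong proj₁ (pos-injective (exit σ j) (exit σ i) e))
    f-distinct i j (inj₂ (e , _)) = ⊥-elim (exit≢entry σ j _ (pos-injective (exit σ j) (entry σ (next σ i)) e))
    to : ∀ p q → X p q → Joins (links σ) p q
    to p q xpq with four f f-distinct f-X p q xpq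
    ... | i , same = Anyₚ.tabulate⁺ {f = link σ} i same
    from : ∀ p q → Joins (links σ) p q → X p q
    from p q j with Anyₚ.tabulate⁻ {f = link σ} j
    ... | i , inj₁ (refl , refl) = f-X i
    ... | i , inj₂ (refl , refl) = X-sym _ _ (f-X i)

-- The paths of a complete selection

module Rotation (m a : ℕ) (a< : a < suc m) where
  private
    n : ℕ
    n = suc m

    %-+ : ∀ y c → (y % n + c) % n ≡ (y + c) % n
    %-+ y c = trans (%-distribˡ-+ (y % n) c n) (trans (cong (λ z → (z + c % n) % n) (m%n%n≡m%n y n)) (sym (%-distribˡ-+ y c n)))

  opaque
    rotate : ℕ → ℕ
    rotate p = (p + suc a) % n

    unrotate : ℕ → ℕ
    unrotate x = (x + (n ∸ suc a)) % n

    rotate< : ∀ p → rotate p < n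
    rotate< p = m%n<n (p + suc a) n

    unrotate< : ∀ x → unrotate x < n
    unrotate< x = m%n<n (x + (n ∸ suc a)) n

    rotate-unrotate : ∀ x → x < n → rotate (unrotate x) ≡ x
    rotate-unrotate x x< = begin
      ((x + (n ∸ suc a)) % n + suc a) % n  ≡⟨ %-+ (x + (n ∸ suc a)) (suc a) ⟩
      (x + (n ∸ suc a) + suc a) % n        ≡⟨ cong (_% n) (trans (+-assoc x (n ∸ suc a) (suc a)) (cong (x +_) (m∸n+n≡m a<))) ⟩
      (x + n) % n                          ≡⟨ [m+n]%n≡m%n x n ⟩
      x % n                                ≡⟨ m<n⇒m%n≡m x< ⟩
      x                                    ∎
      where open ≡-Reasoning

    unrotate-rotate : ∀ p → p < n → unrotate (rotate p) ≡ p
    unrotate-rotate p p< = begin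
      ((p + suc a) % n + (n ∸ suc a)) % n  ≡⟨ %-+ (p + suc a) (n ∸ suc a) ⟩
      (p + suc a + (n ∸ suc a)) % n        ≡⟨ cong (_% n) (trans (+-assoc p (suc a) (n ∸ suc a)) (cong (p +_) (m+[n∸m]≡n a<))) ⟩
      (p + n) % n                          ≡⟨ [m+n]%n≡m%n p n ⟩
      p % n                                ≡⟨ m<n⇒m%n≡m p< ⟩
      p                                    ∎
      where open ≡-Reasoning

    rotate-suc : ∀ p → rotate (suc p) ≡ suc (rotate p) % n
    rotate-suc p = sym (trans (cong (_% n) (+-comm 1 ((p + suc a) % n))) (trans (%-+ (p + suc a) 1) (cong (_% n) (+-comm (p + suc a) 1))))

    rotate-∸ : ∀ i → suc a ≤ i → i < n → rotate (i ∸ suc a) ≡ i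
    rotate-∸ i le i< = trans (cong (_% n) (m∸n+n≡m le)) (m<n⇒m%n≡m i<)

    rotate-m : rotate m ≡ a
    rotate-m = trans (cong (_% n) (trans (+-suc m a) (+-comm n a))) (trans ([m+n]%n≡m%n a n) (m<n⇒m%n≡m a<))

    rotate-0 : rotate 0 ≡ suc a % n
    rotate-0 = refl

  rotate-injective : ∀ p q → p < n → q < n → rotate p ≡ rotate q → p ≡ q
  rotate-injective p q p< q< e = trans (sym (unrotate-rotate p p<)) (trans (cong unrotate e) (unrotate-rotate q q<))

-- The path (k , true) … (k , false) runs from i_k ⊕ 1 to i_{k+1}.
label : End → Label
label (k , true)  = k , true
label (k , false) = next4 k , false

unlabel : Label → End
unlabel (k , true)  = k , true
unlabel (k , false) = prev4 k , false

label-unlabel : ∀ x → label (unlabel x) ≡ x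
label-unlabel (f0 , true) = refl
label-unlabel (f1 , true) = refl
label-unlabel (f2 , true) = refl
label-unlabel (f3 , true) = refl
label-unlabel (f0 , false) = refl
label-unlabel (f1 , false) = refl
label-unlabel (f2 , false) = refl
label-unlabel (f3 , false) = refl

-- the ends of a removed edge {i_j , i_j ⊕ 1} are an end and the start of the next path
label-across : ∀ x y j → label x ≡ (j , false) → label y ≡ (j , true) → y ≡ across x
label-across (f3 , false) (f0 , true) f0 refl refl = refl
label-across (f0 , false) (f1 , true) f1 refl refl = refl
label-across (f1 , false) (f2 , true) f2 refl refl = refl
label-across (f2 , false) (f3 , true) f3 refl refl = refl

module Linearised (m : ℕ) (S : Selection (suc m)) (complete : Complete S) where
  private
    n : ℕ
    n = suc m
    a = i₁ S
    i₄< : i₄ S < n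
    i₄< = i₄<n S
    i₃< : i₃ S < n
    i₃< = <-trans (i₃<i₄ S) i₄<
    i₂< : i₂ S < n
    i₂< = <-trans (i₂<i₃ S) i₃<
    a< : a < n
    a< = <-trans (i₁<i₂ S) i₂<

  open Rotation m a a< public

  private
    a<i₂ : suc a ≤ i₂ S
    a<i₂ = i₁<i₂ S
    a<i₃ : suc a ≤ i₃ S
    a<i₃ = ≤-trans a<i₂ (<⇒≤ (i₂<i₃ S))
    a<i₄ : suc a ≤ i₄ S
    a<i₄ = ≤-trans a<i₃ (<⇒≤ (i₃<i₄ S))

  e₀ e₁ e₂ e₃ : ℕ
  e₀ = i₂ S ∸ suc a
  e₁ = i₃ S ∸ suc a
  e₂ = i₄ S ∸ suc a
  e₃ = m

  private
    rotate-e₀ : rotate e₀ ≡ i₂ S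
    rotate-e₀ = rotate-∸ _ a<i₂ i₂<
    rotate-e₁ : rotate e₁ ≡ i₃ S
    rotate-e₁ = rotate-∸ _ a<i₃ i₃<
    rotate-e₂ : rotate e₂ ≡ i₄ S
    rotate-e₂ = rotate-∸ _ a<i₄ i₄<

    rotate-⊕1 : ∀ p i → rotate p ≡ i → rotate (suc p) ≡ _⊕1 {n} i
    rotate-⊕1 p i e = trans (rotate-suc p) (cong (λ z → suc z % n) e)

    e₀<e₁ : e₀ < e₁
    e₀<e₁ = ∸-monoˡ-< (i₂<i₃ S) a<i₂
    e₁<e₂ : e₁ < e₂
    e₁<e₂ = ∸-monoˡ-< (i₃<i₄ S) a<i₃
    e₂<m : e₂ < m
    e₂<m = ≤-trans (∸-monoˡ-< i₄< a<i₄) (m∸n≤m m a)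

  -- completeness: no selected index follows another one
  h₀ : 0 < e₀
  h₀ = n≢0⇒n>0 λ e → complete f0 (f1 , trans (sym rotate-0) (trans (cong rotate (sym e)) rotate-e₀))
  h₁ : suc e₀ < e₁
  h₁ = ≤∧≢⇒< e₀<e₁ λ e → complete f1 (f2 , trans (sym (rotate-⊕1 e₀ _ rotate-e₀)) (trans (cong rotate e) rotate-e₁))
  h₂ : suc e₁ < e₂
  h₂ = ≤∧≢⇒< e₁<e₂ λ e → complete f2 (f3 , trans (sym (rotate-⊕1 e₁ _ rotate-e₁)) (trans (cong rotate e) rotate-e₂))
  h₃ : suc e₂ < e₃
  h₃ = ≤∧≢⇒< e₂<m λ e → complete f3 (f0 , trans (sym (rotate-⊕1 e₂ _ rotate-e₂)) (trans (cong rotate e) rotate-m))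

  open FourPaths e₀ e₁ e₂ e₃ h₀ h₁ h₂ h₃ public hiding (n)

  vtx-label : ∀ x → vtx S (label x) ≡ rotate (pos x)
  vtx-label (f0 , true) = sym rotate-0
  vtx-label (f1 , true) = sym (rotate-⊕1 e₀ _ rotate-e₀)
  vtx-label (f2 , true) = sym (rotate-⊕1 e₁ _ rotate-e₁)
  vtx-label (f3 , true) = sym (rotate-⊕1 e₂ _ rotate-e₂)
  vtx-label (f0 , false) = sym rotate-e₀
  vtx-label (f1 , false) = sym rotate-e₁
  vtx-label (f2 , false) = sym rotate-e₂
  vtx-label (f3 , false) = sym rotate-m

  vtx< : ∀ x → vtx S x < n
  vtx< x = subst (_< n) (trans (sym (vtx-label (unlabel x))) (cong (vtx S) (label-unlabel x))) (rotate< (pos (unlabel x)))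

  vtx-label-injective : ∀ x y → vtx S (label x) ≡ vtx S (label y) → x ≡ y
  vtx-label-injective x y e = pos-injective x y (rotate-injective _ _ (pos< x) (pos< y) (trans (sym (vtx-label x)) (trans e (vtx-label y))))

  vtx-injective : ∀ x y → vtx S x ≡ vtx S y → x ≡ y
  vtx-injective x y e = trans (sym (label-unlabel x)) (trans (cong label (vtx-label-injective (unlabel x) (unlabel y)
    (trans (cong (vtx S) (label-unlabel x)) (trans e (cong (vtx S) (sym (label-unlabel y))))))) (label-unlabel y))

  Adj-unrotate : ∀ u w p q → u < n → w < n → p < n → q < n → Adj (rotate u) (rotate w) (rotate p) (rotate q) → Adj u w p q
  Adj-unrotate u w p q u< w< p< q< (inj₁ (x , y)) = inj₁ (rotate-injective p u p< u< x , rotate-injective q w q< w< y)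
  Adj-unrotate u w p q u< w< p< q< (inj₂ (x , y)) = inj₂ (rotate-injective p w p< w< x , rotate-injective q u q< u< y)

  private
    InSel-Inner : ∀ y → y < n → InSel S (rotate y) → y ≡ m ⊎ y ≡ e₀ ⊎ y ≡ e₁ ⊎ y ≡ e₂
    InSel-Inner y y< (f0 , e) = inj₁ (rotate-injective y m y< ≤-refl (trans e (sym rotate-m)))
    InSel-Inner y y< (f1 , e) = inj₂ (inj₁ (rotate-injective y e₀ y< (<-trans e₀<e₁ (<-trans e₁<e₂ (<-trans e₂<m ≤-refl))) (trans e (sym rotate-e₀))))
    InSel-Inner y y< (f2 , e) = inj₂ (inj₂ (inj₁ (rotate-injective y e₁ y< (<-trans e₁<e₂ (<-trans e₂<m ≤-refl)) (trans e (sym rotate-e₁)))))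
    InSel-Inner y y< (f3 , e) = inj₂ (inj₂ (inj₂ (rotate-injective y e₂ y< (<-trans e₂<m ≤-refl) (trans e (sym rotate-e₂)))))

  TminusR⇔Paths : ∀ p q → p < n → q < n → TminusR S (rotate p) (rotate q) ⇔ Paths p q
  TminusR⇔Paths p q p< q< = mk⇔ to from
    where
    to : TminusR S (rotate p) (rotate q) → Paths p q
    to (x , x< , x∉ , ad) = y , inner , Adj-unrotate y (suc y) p q (unrotate< x) (s≤s y<m) p< q< ad′
      where
      y = unrotate x
      rotate-y : rotate y ≡ x
      rotate-y = rotate-unrotate x x<
      y<m : y < m
      y<m = ≤∧≢⇒< (s≤s⁻¹ (unrotate< x)) λ e → x∉ (f0 , trans (sym rotate-y) (trans (cong rotate e) rotate-m))
      inner : Inner y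
      inner = y<m , (λ e → x∉ (f1 , trans (sym rotate-y) (trans (cong rotate e) rotate-e₀)))
                  , (λ e → x∉ (f2 , trans (sym rotate-y) (trans (cong rotate e) rotate-e₁)))
                  , (λ e → x∉ (f3 , trans (sym rotate-y) (trans (cong rotate e) rotate-e₂)))
      ad′ : Adj (rotate y) (rotate (suc y)) (rotate p) (rotate q)
      ad′ = subst₂ (λ u w → Adj u w (rotate p) (rotate q)) (sym rotate-y) (sym (rotate-⊕1 y x rotate-y)) ad
    from : Paths p q → TminusR S (rotate p) (rotate q)
    from (y , inner@(y< , y≢e₀ , y≢e₁ , y≢e₂) , ad) =
      rotate y , rotate< y , not-selected , subst (λ z → Adj (rotate y) z (rotate p) (rotate q)) (rotate-⊕1 y (rotate y) refl) (Adj-map rotate ad)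
      where
      not-selected : ¬ InSel S (rotate y)
      not-selected i with InSel-Inner y (<-trans y< ≤-refl) i
      ... | inj₁ e = <-irrefl e y<
      ... | inj₂ (inj₁ e) = y≢e₀ e
      ... | inj₂ (inj₂ (inj₁ e)) = y≢e₁ e
      ... | inj₂ (inj₂ (inj₂ e)) = y≢e₂ e

  label-across-removed : ∀ x → ∃[ j ] SameEdge (vtx S (label x) , vtx S (label (across x))) (removed S j)
  label-across-removed (k , false) = next4 k , inj₁ (refl , refl)
  label-across-removed (f0 , true) = f0 , inj₂ (refl , refl)
  label-across-removed (f1 , true) = f1 , inj₂ (refl , refl)
  label-across-removed (f2 , true) = f2 , inj₂ (refl , refl)
  label-across-removed (f3 , true) = f3 , inj₂ (refl , refl)

  removed-across : ∀ x y j → SameEdge (vtx S (label x) , vtx S (label y)) (removed S j) → y ≡ across x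
  removed-across x y j (inj₁ (a , b)) = label-across x y j (vtx-injective _ (j , false) (sym a)) (vtx-injective _ (j , true) (sym b))
  removed-across x y j (inj₂ (a , b)) =
    trans (sym (across-involutive y)) (cong across (sym (label-across y x j (vtx-injective _ (j , false) (sym a)) (vtx-injective _ (j , true) (sym b)))))

-- Labels and the action of 𝒢

_≟ˡ_ : (x y : Label) → Dec (x ≡ y)
_≟ˡ_ = ≡-dec _≟ᶠ_ _≟ᵇ_

LabelPair : Set
LabelPair = Label × Label

SamePair : LabelPair → LabelPair → Set
SamePair (x , y) (u , w) = (x ≡ u × y ≡ w) ⊎ (x ≡ w × y ≡ u)

samePair? : ∀ p r → Dec (SamePair p r)
samePair? (x , y) (u , w) = ((x ≟ˡ u) ×-dec (y ≟ˡ w)) ⊎-dec ((x ≟ˡ w) ×-dec (y ≟ˡ u))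

infix 4 _⊆ᵖ_ _≈ᵖ_ _≈ᵖ?_
infixr 5 _·_

_⊆ᵖ_ : List LabelPair → List LabelPair → Set
Q ⊆ᵖ R = All (λ p → Any (SamePair p) R) Q

_≈ᵖ_ : List LabelPair → List LabelPair → Set
Q ≈ᵖ R = Q ⊆ᵖ R × R ⊆ᵖ Q

_≈ᵖ?_ : ∀ Q R → Dec (Q ≈ᵖ R)
Q ≈ᵖ? R = All.all? (λ p → Any.any? (samePair? p) R) Q ×-dec All.all? (λ p → Any.any? (samePair? p) Q) R

_·_ : G → List LabelPair → List LabelPair
φ · Q = map (λ p → L φ (proj₁ p) , L φ (proj₂ p)) Q

linkLabels : Scheme → List LabelPair
linkLabels σ = map (λ uw → label (proj₁ uw) , label (proj₂ uw)) (links σ)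

∀G? : {P : G → Set} → (∀ φ → Dec (P φ)) → Dec (∀ φ → P φ)
∀G? P? with all? (λ j → P? (false , j)) | all? (λ j → P? (true , j))
... | yes f | yes t = yes λ { (false , j) → f j ; (true , j) → t j }
... | no ¬f | _     = no λ h → ¬f (λ j → h (false , j))
... | yes _ | no ¬t = no λ h → ¬t (λ j → h (true , j))

∃G? : {P : G → Set} → (∀ φ → Dec (P φ)) → Dec (∃[ φ ] P φ)
∃G? P? with any? (λ j → P? (false , j)) | any? (λ j → P? (true , j))
... | yes (j , p) | _           = yes ((false , j) , p)
... | no _        | yes (j , p) = yes ((true , j) , p)
... | no ¬f       | no ¬t       = no λ { ((false , j) , p) → ¬f (j , p) ; ((true , j) , p) → ¬t (j , p) }

representative : Fin 7 → Scheme
representative = Vec.lookup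
  (signed (f1 , f2 , f3) (false , true , false) ∷ signed (f1 , f2 , f3) (false , false , false) ∷
   signed (f1 , f3 , f2) (false , true , true) ∷ signed (f1 , f3 , f2) (false , true , false) ∷
   signed (f1 , f3 , f2) (false , false , true) ∷ signed (f2 , f3 , f1) (false , false , true) ∷
   signed (f3 , f2 , f1) (true , true , true) ∷ [])

-- decided by evaluation
opaque
  orbits-closed : All (λ σ → ∀ φ → Any (λ τ → φ · linkLabels σ ≈ᵖ linkLabels τ) pureSchemes) pureSchemes
  orbits-closed = from-yes (All.all? (λ σ → ∀G? λ φ → Any.any? (λ τ → (φ · linkLabels σ) ≈ᵖ? linkLabels τ) pureSchemes) pureSchemes)

  representatives-cover : All (λ σ → ∃[ φ ] ∃[ i ] (φ · linkLabels σ ≈ᵖ linkLabels (representative i))) pureSchemes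
  representatives-cover = from-yes (All.all? (λ σ → ∃G? λ φ → any? λ i → (φ · linkLabels σ) ≈ᵖ? linkLabels (representative i)) pureSchemes)

  representatives-separated : ∀ φ i j → φ · linkLabels (representative i) ≈ᵖ linkLabels (representative j) → i ≡ j
  representatives-separated = from-yes (∀G? λ φ → all? λ i → all? λ j → (φ · linkLabels (representative i)) ≈ᵖ? linkLabels (representative j) →-dec (i ≟ᶠ j))

  representatives-valid : ∀ i → Valid (representative i)
  representatives-valid = from-yes (all? λ i → valid? (representative i))

-- label pairs as edges of the complete graph, for a selection whose eight labelled vertices are distinct
module Realisation {n} .{{_ : NonZero n}} (S : Selection n) (vtx-injective : ∀ x y → vtx S x ≡ vtx S y → x ≡ y) where
  edge : LabelPair → Edge
  edge (x , y) = vtx S x , vtx S y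

  edges : List LabelPair → List Edge
  edges = map edge

  private
    SameEdge-edge : ∀ p r → SameEdge (edge p) (edge r) → SamePair r p
    SameEdge-edge (x , y) (u , w) (inj₁ (a , b)) = inj₁ (vtx-injective u x a , vtx-injective w y b)
    SameEdge-edge (x , y) (u , w) (inj₂ (a , b)) = inj₂ (vtx-injective u y a , vtx-injective w x b)

    SamePair-edge : ∀ p r → SamePair p r → SameEdge (edge r) (edge p)
    SamePair-edge _ _ (inj₁ (refl , refl)) = inj₁ (refl , refl)
    SamePair-edge _ _ (inj₂ (refl , refl)) = inj₂ (refl , refl)

  ⊆ᵖ-sound : ∀ {Q R} → Q ⊆ᵖ R → ∀ a b → ⟦ edges Q ⟧ a b → ⟦ edges R ⟧ a b
  ⊆ᵖ-sound Q⊆R a b e with find (Anyₚ.map⁻ e)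
  ... | p , p∈Q , same with find (All.lookup Q⊆R p∈Q)
  ...   | r , r∈R , pr = Anyₚ.map⁺ (Any.map (λ { refl → SameEdge-trans _ _ _ (SamePair-edge p r pr) same }) r∈R)

  ⊆ᵖ-complete : ∀ {Q R} → (∀ a b → ⟦ edges Q ⟧ a b → ⟦ edges R ⟧ a b) → Q ⊆ᵖ R
  ⊆ᵖ-complete {Q} Q⊆R = All.tabulate λ {p} p∈Q → Any.map (λ {r} same → SameEdge-edge r p same)
                          (Anyₚ.map⁻ (Q⊆R _ _ (Anyₚ.map⁺ (Any.map (λ { refl → inj₁ (refl , refl) }) p∈Q))))

  ≈ᵖ⇒≐ : ∀ {Q R} → Q ≈ᵖ R → ⟦ edges Q ⟧ ≐ ⟦ edges R ⟧
  ≈ᵖ⇒≐ (Q⊆R , R⊆Q) a b = mk⇔ (⊆ᵖ-sound Q⊆R a b) (⊆ᵖ-sound R⊆Q a b)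

  ≐⇒≈ᵖ : ∀ {Q R} → ⟦ edges Q ⟧ ≐ ⟦ edges R ⟧ → Q ≈ᵖ R
  ≐⇒≈ᵖ Q≐R = ⊆ᵖ-complete (λ a b → Equivalence.to (Q≐R a b)) , ⊆ᵖ-complete (λ a b → Equivalence.from (Q≐R a b))

  act-edges : ∀ φ Q → act S φ (edges Q) ≐ ⟦ edges (φ · Q) ⟧
  act-edges φ Q a b = mk⇔ to from
    where
    to : act S φ (edges Q) a b → ⟦ edges (φ · Q) ⟧ a b
    to (x , y , e , refl , refl) with find (Anyₚ.map⁻ e)
    ... | (u , w) , uw∈Q , inj₁ (p , q) with refl ← vtx-injective x u p | refl ← vtx-injective y w q =
      Anyₚ.map⁺ (Anyₚ.map⁺ (Any.map (λ { refl → inj₁ (refl , refl) }) uw∈Q))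
    ... | (u , w) , uw∈Q , inj₂ (p , q) with refl ← vtx-injective x w p | refl ← vtx-injective y u q =
      Anyₚ.map⁺ (Anyₚ.map⁺ (Any.map (λ { refl → inj₂ (refl , refl) }) uw∈Q))
    from : ⟦ edges (φ · Q) ⟧ a b → act S φ (edges Q) a b
    from e with find (Anyₚ.map⁻ (Anyₚ.map⁻ e))
    ... | (u , w) , uw∈Q , inj₁ (p , q) = u , w , Anyₚ.map⁺ (Any.map (λ { refl → inj₁ (refl , refl) }) uw∈Q) , p , q
    ... | (u , w) , uw∈Q , inj₂ (p , q) = w , u , Anyₚ.map⁺ (Any.map (λ { refl → inj₂ (refl , refl) }) uw∈Q) , p , q

-- Pure reinsertion sets

module Reinsertions (m : ℕ) (S : Selection (suc m)) (complete : Complete S) where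
  open Linearised m S complete
  open Realisation S vtx-injective

  private
    n : ℕ
    n = suc m

    label² : End × End → LabelPair
    label² (u , w) = label u , label w

    edges-bounded : ∀ Q → All (λ e → proj₁ e < n × proj₂ e < n) (edges Q)
    edges-bounded Q = Allₚ.map⁺ {f = edge} (All.tabulate {xs = Q} λ {(x , y)} _ → vtx< x , vtx< y)

    TminusR-bounded : ∀ a b → TminusR S a b → a < n × b < n
    TminusR-bounded a b (x , x< , _ , inj₁ (refl , refl)) = x< , m%n<n (suc x) n
    TminusR-bounded a b (x , x< , _ , inj₂ (refl , refl)) = m%n<n (suc x) n , x<

    Joins⇔edges : ∀ P p q → p < n → q < n → Joins P p q ⇔ ⟦ edges (map label² P) ⟧ (rotate p) (rotate q)
    Joins⇔edges P p q p< q< = mk⇔ to from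
      where
      to : Joins P p q → ⟦ edges (map label² P) ⟧ (rotate p) (rotate q)
      to j = Anyₚ.map⁺ (Anyₚ.map⁺ (Any.map (λ {(u , w)} ad → subst₂ (λ x y → Adj x y (rotate p) (rotate q)) (sym (vtx-label u)) (sym (vtx-label w)) (Adj-map rotate ad)) j))
      from : ⟦ edges (map label² P) ⟧ (rotate p) (rotate q) → Joins P p q
      from e = Any.map (λ {(u , w)} ad → Adj-unrotate (pos u) (pos w) p q (pos< u) (pos< w) p< q<
                 (subst₂ (λ x y → Adj x y (rotate p) (rotate q)) (vtx-label u) (vtx-label w) ad)) (Anyₚ.map⁻ (Anyₚ.map⁻ e))

  reinsertion : Scheme → List Edge
  reinsertion σ = edges (linkLabels σ)

  reinsertion-pure : ∀ σ → Valid σ → PureReinsertionSet S (reinsertion σ)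
  reinsertion-pure σ (pure , next-injective , next-cyclic) = (refl , is-edges , distinct , ham) , avoids-removed
    where
    is-edges : All (IsEdge n) (reinsertion σ)
    is-edges = Allₚ.map⁺ {f = edge} (Allₚ.map⁺ {f = label²} (Allₚ.tabulate⁺ {f = link σ} λ k → vtx< (label (exit σ k)) , vtx< (label (entry σ (next σ k))) , λ e → exit≢entry σ k _ (vtx-label-injective _ _ e)))
    distinct : AllPairs (λ e f → ¬ SameEdge e f) (reinsertion σ)
    distinct = AllPairsₚ.map⁺ {f = edge} (AllPairsₚ.map⁺ {f = label²} (AllPairsₚ.tabulate⁺ {f = link σ} λ {i} {j} i≢j → λ
      { (inj₁ (e , _)) → i≢j (sym (cong proj₁ (vtx-label-injective (exit σ j) (exit σ i) e)))
      ; (inj₂ (e , _)) → exit≢entry σ j _ (vtx-label-injective (exit σ j) (entry σ (next σ i)) e) }))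
    avoids-removed : All (λ e → ∀ j → ¬ SameEdge e (removed S j)) (reinsertion σ)
    avoids-removed = Allₚ.map⁺ {f = edge} (Allₚ.map⁺ {f = label²} (Allₚ.tabulate⁺ {f = link σ} λ k j same → pure k (removed-across (exit σ k) (entry σ (next σ k)) j same)))
    ham : HamCycle n (TminusR S ∪ ⟦ reinsertion σ ⟧)
    ham = HamCycle-relabel rotate unrotate (λ p _ → rotate< p) (λ x _ → unrotate< x) rotate-unrotate unrotate-rotate
            (SchemeCycle.Cycle e₀ e₁ e₂ e₃ h₀ h₁ h₂ h₃ σ next-injective cyclic) (TminusR S ∪ ⟦ reinsertion σ ⟧)
            (λ { a b (inj₁ t) → TminusR-bounded a b t ; a b (inj₂ j) → ⟦⟧-bounded (reinsertion σ) (edges-bounded (linkLabels σ)) j })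
            (λ p q p< q< → ⇔-sym (TminusR⇔Paths p q p< q<) ⊎-⇔ Joins⇔edges (links σ) p q p< q<)
            (SchemeCycle.HamCycle-scheme e₀ e₁ e₂ e₃ h₀ h₁ h₂ h₃ σ next-injective cyclic)
      where
      cyclic : ∀ k → ∃[ j ] (fold f0 (next σ) j ≡ k)
      cyclic k = toℕ (proj₁ (next-cyclic k)) , proj₂ (next-cyclic k)

  private
    module Inserted (I : List Edge) (pure : PureReinsertionSet S I) where
      four : length I ≡ 4
      four = proj₁ (proj₁ pure)
      is-edges : All (IsEdge n) I
      is-edges = proj₁ (proj₂ (proj₁ pure))
      ham : HamCycle n (TminusR S ∪ ⟦ I ⟧)
      ham = proj₂ (proj₂ (proj₂ (proj₁ pure)))
      avoids-removed : All (λ e → ∀ j → ¬ SameEdge e (removed S j)) I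
      avoids-removed = proj₂ pure

      I-bounded : ∀ {a b} → ⟦ I ⟧ a b → a < n × b < n
      I-bounded = ⟦⟧-bounded I (All.map (λ { (a< , b< , _) → a< , b< }) is-edges)

      -- the inserted edges, in positions
      X : EdgeSet
      X p q = p < n × q < n × ⟦ I ⟧ (rotate p) (rotate q)

      X-pure : ∀ x → ¬ X (pos x) (pos (across x))
      X-pure x (_ , _ , i) with find (subst₂ ⟦ I ⟧ (sym (vtx-label x)) (sym (vtx-label (across x))) i)
      ... | e , e∈I , same with label-across-removed x
      ...   | j , removed-j = All.lookup avoids-removed e∈I j (SameEdge-trans e _ (removed S j) same removed-j)

      at-rotate : ∀ (R : EdgeSet) a b → a < n → b < n → R a b ⇔ R (rotate (unrotate a)) (rotate (unrotate b))
      at-rotate R a b a< b< rewrite rotate-unrotate a a< | rotate-unrotate b b< = mk⇔ (λ r → r) (λ r → r)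

      I⇔X : ∀ a b → a < n → b < n → ⟦ I ⟧ a b ⇔ X (unrotate a) (unrotate b)
      I⇔X a b a< b< = mk⇔ (λ i → unrotate< a , unrotate< b , Equivalence.to (at-rotate ⟦ I ⟧ a b a< b<) i)
                          (λ (_ , _ , i) → Equivalence.from (at-rotate ⟦ I ⟧ a b a< b<) i)

      linear-ham : HamCycle n (λ p q → Paths p q ⊎ X p q)
      linear-ham = HamCycle-relabel unrotate rotate (λ x _ → unrotate< x) (λ p _ → rotate< p) unrotate-rotate rotate-unrotate
        (TminusR S ∪ ⟦ I ⟧) (λ p q → Paths p q ⊎ X p q)
        (λ { p q (inj₁ t) → Paths-bounded p q t ; p q (inj₂ (p< , q< , _)) → p< , q< })
        (λ a b a< b< → (TminusR⇔Paths _ _ (unrotate< a) (unrotate< b) ⇔-∘ at-rotate (TminusR S) a b a< b<) ⊎-⇔ I⇔X a b a< b<)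
        ham

      linked : AtMost4Edges X
      linked f f-distinct f-X p q (p< , q< , i) with ⟦⟧-exhausted I four rotated rotated-distinct (λ i → proj₂ (proj₂ (f-X i))) _ _ i
        where
        rotated : Fin 4 → Edge
        rotated i = rotate (proj₁ (f i)) , rotate (proj₂ (f i))
        rotated-distinct : ∀ i j → SameEdge (rotated i) (rotated j) → i ≡ j
        rotated-distinct i j same = f-distinct i j (Adj-unrotate _ _ _ _ (proj₁ (f-X i)) (proj₁ (proj₂ (f-X i))) (proj₁ (f-X j)) (proj₁ (proj₂ (f-X j))) same)
      ... | k , same = k , Adj-unrotate _ _ p q (proj₁ (f-X k)) (proj₁ (proj₂ (f-X k))) p< q< same

      open CycleScheme e₀ e₁ e₂ e₃ h₀ h₁ h₂ h₃ X (λ p q x → proj₁ x , proj₁ (proj₂ x))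
        (λ p q (p< , q< , i) → q< , p< , ⟦⟧-sym I i) X-pure linear-ham using (X-links)

      opaque
        X-scheme : ∃[ σ ] (σ ∈ pureSchemes × ∀ p q → X p q ⇔ Joins (links σ) p q)
        X-scheme = X-links linked

  pure-reinsertion : ∀ I → PureReinsertionSet S I → ∃[ σ ] (σ ∈ pureSchemes × ⟦ I ⟧ ≐ ⟦ reinsertion σ ⟧)
  pure-reinsertion I pure with Inserted.X-scheme I pure
  ... | σ , σ∈ , X⇔Joins = σ , σ∈ , λ a b → mk⇔ (to a b) (from a b)
    where
    open Inserted I pure using (I-bounded; at-rotate)
    to : ∀ a b → ⟦ I ⟧ a b → ⟦ reinsertion σ ⟧ a b
    to a b i with I-bounded i
    ... | a< , b< = Equivalence.from (at-rotate ⟦ reinsertion σ ⟧ a b a< b<)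
          (Equivalence.to (Joins⇔edges (links σ) _ _ (unrotate< a) (unrotate< b))
            (Equivalence.to (X⇔Joins _ _) (unrotate< a , unrotate< b , Equivalence.to (at-rotate ⟦ I ⟧ a b a< b<) i)))
    from : ∀ a b → ⟦ reinsertion σ ⟧ a b → ⟦ I ⟧ a b
    from a b j with ⟦⟧-bounded (reinsertion σ) (edges-bounded (linkLabels σ)) j
    ... | a< , b< = Equivalence.from (at-rotate ⟦ I ⟧ a b a< b<)
          (proj₂ (proj₂ (Equivalence.from (X⇔Joins _ _)
            (Equivalence.from (Joins⇔edges (links σ) _ _ (unrotate< a) (unrotate< b)) (Equivalence.to (at-rotate ⟦ reinsertion σ ⟧ a b a< b<) j)))))

  valid : ∀ {σ} → σ ∈ pureSchemes → Valid σ
  valid σ∈ = All.lookup pureSchemes-valid σ∈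

  orbit-of : ∀ φ σ → act S φ (reinsertion σ) ≐ ⟦ edges (φ · linkLabels σ) ⟧
  orbit-of φ σ = act-edges φ (linkLabels σ)

  action-closed : ∀ φ I → PureReinsertionSet S I → ∃[ J ] (PureReinsertionSet S J × act S φ I ≐ ⟦ J ⟧)
  action-closed φ I pure with pure-reinsertion I pure
  ... | σ , σ∈ , I≐σ with find (All.lookup orbits-closed σ∈ φ)
  ...   | τ , τ∈ , φσ≈τ = reinsertion τ , reinsertion-pure τ (valid τ∈) ,
          ≐-trans (act-cong S φ I≐σ) (≐-trans (orbit-of φ σ) (≈ᵖ⇒≐ φσ≈τ))

  orbit-representatives : Σ (Fin 7 → List Edge) λ J →
    (∀ k → PureReinsertionSet S (J k)) × (∀ k l → SameOrbit S (J k) (J l) → k ≡ l) ×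
    (∀ I → PureReinsertionSet S I → ∃[ k ] SameOrbit S I (J k))
  orbit-representatives = J , (λ k → reinsertion-pure _ (representatives-valid k)) , separated , covered
    where
    J : Fin 7 → List Edge
    J k = reinsertion (representative k)
    separated : ∀ k l → SameOrbit S (J k) (J l) → k ≡ l
    separated k l (φ , φk≐l) = representatives-separated φ k l (≐⇒≈ᵖ (≐-trans (≐-sym (orbit-of φ (representative k))) φk≐l))
    covered : ∀ I → PureReinsertionSet S I → ∃[ k ] SameOrbit S I (J k)
    covered I pure with pure-reinsertion I pure
    ... | σ , σ∈ , I≐σ with All.lookup representatives-cover σ∈
    ...   | φ , k , φσ≈k = k , φ , ≐-trans (act-cong S φ I≐σ) (≐-trans (orbit-of φ σ) (≈ᵖ⇒≐ φσ≈k))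

proposition2 : (n : ℕ) → .{{_ : NonZero n}} → (S : Selection n) → Complete S →
    (∀ (φ : G) (I : List Edge) → PureReinsertionSet S I →
       ∃[ J ] (PureReinsertionSet S J × (act S φ I ≐ ⟦ J ⟧))) ×
    (Σ (Fin 7 → List Edge) λ J →
       (∀ k → PureReinsertionSet S (J k)) ×
       (∀ k l → SameOrbit S (J k) (J l) → k ≡ l) ×
       (∀ I → PureReinsertionSet S I → ∃[ k ] SameOrbit S I (J k)))
proposition2 (suc m) S complete = action-closed , orbit-representatives
  where open Reinsertions m S complete
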